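{- Let $G$ and $H$ be vertex-disjoint connected graphs, let $u_1,\dots,u_k$ be pairwise distinct vertices of $G$ and $v_1,\dots,v_k$ pairwise distinct vertices of $H$. Suppose that $G_S$ and $H_S$ are $T$-equivalent for every subset $S$ of $\{\{i,j\}:1\le i<j\le k\}$. Then for an arbitrary graph $W$ (vertex-disjoint from $G$ and $H$) with pairwise distinct vertices $w_1,\dots,w_k$, the graphs $G(u_1,\dots,u_k)\sqcup W(w_1,\dots,w_k)$ and $H(v_1,\dots,v_k)\sqcup W(w_1,\dots,w_k)$ are $T$-equivalent.
   Context: Graphs may have loops and parallel edges. The Tutte polynomial of $G=(V,E)$ is $T_G(x,y)=\sum_{A\subseteq E}(x-1)^{r(E)-r(A)}(y-1)^{|A|-r(A)}$ with $r(A)=|V|-c(A)$, $c(A)$ the number of components of $(V,A)$. Two graphs are $T$-equivalent if they have the same Tutte polynomial. For $S\subseteq\{\{i,j\}:1\le i<j\le k\}$, $G_S$ is the graph obtained from $G$ by adding, for each $\{i,j\}\in S$, one new edge joining $u_i$ and $u_j$; $H_S$ is defined analogously using $v_i,v_j$. For vertex-disjoint graphs $G,W$ with $u_1,\dots,u_k\in V(G)$ and $w_1,\dots,w_k\in V(W)$, $G(u_1,\dots,u_k)\sqcup W(w_1,\dots,w_k)$ is the graph obtained from $G$ and $W$ by identifying $u_i$ and $w_i$ into a single vertex for every $i\in\{1,\dots,k\}$. -}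

module Defs where

open import Data.Nat using (ℕ; zero; suc; _+_; _∸_; _≡ᵇ_; _<ᵇ_; _<?_)
open import Data.Fin using (Fin; toℕ; fromℕ<)
open import Data.List using (List; []; _∷_; [_]; _++_; map; foldr; foldl; length; allFin; concatMap; mapMaybe)
open import Data.Product using (_×_; _,_)
open import Data.Bool using (Bool; true; false; if_then_else_; _∧_; not)
open import Data.Maybe using (Maybe; just; nothing)
open import Data.Integer as ℤ using (ℤ)
open import Relation.Nullary using (yes; no)
open import Relation.Binary.PropositionalEquality using (_≡_)

-- A finite multigraph (loops and parallel edges allowed): vertex set Fin nV,
-- edges given as a list (each list entry is one edge; repetitions = parallel edges).
record Graph : Set where
  constructor graph
  field
    nV    : ℕ
    edges : List (Fin nV × Fin nV)
open Graph public

-- All subsets of a list of edges (taken by position, so parallel edges are distinct).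
subsets : {A : Set} → List A → List (List A)
subsets []       = [ [] ]
subsets (x ∷ xs) = subsets xs ++ map (x ∷_) (subsets xs)

-- Component labelling: every vertex carries the index of a representative of its
-- component; adding edge (a , b) relabels b's component with a's label.
merge : {n : ℕ} → (Fin n → ℕ) → Fin n × Fin n → (Fin n → ℕ)
merge L (a , b) v = if L v ≡ᵇ L b then L a else L v

labels : {n : ℕ} → List (Fin n × Fin n) → Fin n → ℕ
labels A = foldl merge toℕ A

countB : {X : Set} → (X → Bool) → List X → ℕ
countB p xs = foldr (λ x acc → if p x then suc acc else acc) 0 xs

-- c(A): number of connected components of the spanning subgraph (V, A)
-- (= number of component representatives).
components : (G : Graph) → List (Fin (nV G) × Fin (nV G)) → ℕ
components G A = countB (λ v → labels A v ≡ᵇ toℕ v) (allFin (nV G))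

rank : (G : Graph) → List (Fin (nV G) × Fin (nV G)) → ℕ
rank G A = nV G ∸ components G A

sumℤ : List ℤ → ℤ
sumℤ = foldr ℤ._+_ (ℤ.+ 0)

tutte : Graph → ℤ → ℤ → ℤ
tutte G x y =
  sumℤ (map (λ A → ((x ℤ.- ℤ.+ 1) ℤ.^ (rank G (edges G) ∸ rank G A))
                   ℤ.* ((y ℤ.- ℤ.+ 1) ℤ.^ (length A ∸ rank G A)))
            (subsets (edges G)))

-- T-equivalence: equal Tutte polynomials (polynomials over ℤ are equal iff
-- they agree at every point of ℤ²).
TEquiv : Graph → Graph → Set
TEquiv G H = ∀ (x y : ℤ) → tutte G x y ≡ tutte H x y

Connected : Graph → Set
Connected G = components G (edges G) ≡ 1

-- G_S : S ⊆ {{i,j} : i < j} is given by its indicator S i j, read only for i < j.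
withPairs : {k : ℕ} (G : Graph) → (Fin k → Fin (nV G)) → (Fin k → Fin k → Bool) → Graph
withPairs {k} G u S = graph (nV G) (edges G ++ extra)
  where
  extra : List (Fin (nV G) × Fin (nV G))
  extra = concatMap (λ i → concatMap (λ j →
            if S i j ∧ (toℕ i <ᵇ toℕ j) then [ (u i , u j) ] else [])
            (allFin k)) (allFin k)

preimage : {k m : ℕ} → (Fin k → Fin m) → Fin m → Maybe (Fin k)
preimage {k} w x = foldr (λ i r → if toℕ (w i) ≡ᵇ toℕ x then just i else r) nothing (allFin k)

inImage : {k m : ℕ} → (Fin k → Fin m) → Fin m → Bool
inImage w x with preimage w x
... | just _  = true
... | nothing = false

-- G(u_1..u_k) ⊔ W(w_1..w_k): vertices are those of G (indices 0..n-1) followed by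
-- the vertices of W not among w_1..w_k (in increasing order); w_i is identified with u_i.
glue : {k : ℕ} (G : Graph) → (Fin k → Fin (nV G)) → (W : Graph) → (Fin k → Fin (nV W)) → Graph
glue {k} G u W w = graph N (mapMaybe mvG (edges G) ++ mapMaybe mvW (edges W))
  where
  N : ℕ
  N = nV G + (nV W ∸ k)
  toV : ℕ → Maybe (Fin N)
  toV m with m <? N
  ... | yes p = just (fromℕ< p)
  ... | no _  = nothing
  idxW : Fin (nV W) → ℕ
  idxW x with preimage w x
  ... | just i  = toℕ (u i)
  ... | nothing = nV G + countB (λ y → (toℕ y <ᵇ toℕ x) ∧ not (inImage w y)) (allFin (nV W))
  pairM : Maybe (Fin N) → Maybe (Fin N) → Maybe (Fin N × Fin N)
  pairM (just a) (just b) = just (a , b)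
  pairM _        _        = nothing
  mvG : Fin (nV G) × Fin (nV G) → Maybe (Fin N × Fin N)
  mvG (a , b) = pairM (toV (toℕ a)) (toV (toℕ b))
  mvW : Fin (nV W) × Fin (nV W) → Maybe (Fin N × Fin N)
  mvW (a , b) = pairM (toV (idxW a)) (toV (idxW b))

-- Expand T(G ⊔ W) over the edge sets A ∪ B with A ⊆ E(G) and B ⊆ E(W). The components of A ∪ B are those
-- of A ∪ S_B in G, where S_B joins the terminals that B connects inside W (the least terminal of each class of B
-- to the others), together with the classes of B containing no terminal. Hence the (A , B)-term factors as a
-- W-weight of B, independent of G, times the term of A ∪ S_B in T(G_{S_B}), and
--   T(G ⊔ W) = Σ_B weight(B) · Q_G(S_B),   Q_G(P) = the part of T(G_P) over edge sets containing P.
-- As T(G_S) = Σ_{P ⊆ S} Q_G(P), the hypothesis T(G_S) = T(H_S) for all S gives Q_G = Q_H by Möbius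
-- inversion, so T(G ⊔ W) = T(H ⊔ W).
module Submission where

open import Defs
open import Algebra.Bundles using (AbelianGroup)
open import Data.Bool using (Bool; true; false; if_then_else_; _∧_; _∨_; not; T)
open import Data.Bool.Properties using (T-≡; ∧-zeroʳ; ∧-assoc; ∧-comm; ⇔→≡)
open import Data.Empty using (⊥-elim)
open import Data.Fin as F using (Fin; zero; suc; toℕ; _↑ˡ_; _↑ʳ_; splitAt; fromℕ<)
open import Data.Fin.Properties
  using ( toℕ-injective; suc-injective; toℕ<n; toℕ-↑ˡ; toℕ-↑ʳ; toℕ-fromℕ<; fromℕ<-toℕ
        ; splitAt-↑ˡ; splitAt-↑ʳ; splitAt⁻¹-↑ˡ; splitAt⁻¹-↑ʳ)
open import Data.Integer as ℤ using (ℤ; +_)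
import Data.Integer.Properties as ℤP
open import Data.Integer.Tactic.RingSolver using (solve-∀)
open import Data.List
  using (List; []; _∷_; [_]; _++_; map; foldr; length; allFin; tabulate; concatMap; mapMaybe; filterᵇ; cartesianProduct)
open import Data.List.Properties
  using (map-∘; map-++; ++-assoc; ++-identityʳ; foldl-++; length-++; length-map; map-tabulate; filter-++)
open import Data.List.Membership.Propositional using (_∈_)
import Data.List.Membership.DecPropositional as DecMembership
open import Data.List.Membership.Propositional.Properties
  using (∈-map⁺; ∈-map⁻; ∈-++⁺ˡ; ∈-++⁺ʳ; ∈-++⁻; ∈-filter⁺; ∈-filter⁻; ∈-cartesianProduct⁺; ∈-allFin)
import Data.List.Relation.Unary.AllPairs as AllPairs
open import Data.List.Relation.Unary.Any using (here; there)
open import Data.List.Relation.Unary.Unique.Propositional using (Unique)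
open import Data.List.Relation.Unary.Unique.Propositional.Properties using (Unique[x∷xs]⇒x∉xs; cartesianProduct⁺; allFin⁺)
open import Data.Maybe as Maybe using (Maybe; just; nothing; is-nothing)
open import Data.Nat as ℕ using (ℕ; zero; suc; _+_; _∸_; _≤_; _<_; z≤n; s≤s; _≡ᵇ_; _<ᵇ_; _<?_)
open import Data.Nat.Properties hiding (suc-injective; _≟_)
open import Data.Product using (Σ; _×_; _,_; proj₁; proj₂)
import Data.Product as Prod
open import Data.Product.Properties using (≡-dec)
open import Data.Sum using (inj₁; inj₂)
open import Function using (_∘_; id; mk⇔; Equivalence)
open import Function.Definitions using (Injective)
open import Relation.Binary.Definitions using (DecidableEquality; tri<; tri≈; tri>)
open import Relation.Binary.PropositionalEquality hiding ([_])
open import Relation.Nullary using (yes; no; does)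
open import Relation.Nullary.Decidable using (dec-true; dec-false; does-⇔)
open import Relation.Nullary.Decidable.Core using (T?)
open import Algebra.Properties.CommutativeSemigroup +-commutativeSemigroup
  using () renaming (interchange to +-interchange)
open import Algebra.Properties.CommutativeSemigroup ℤP.+-commutativeSemigroup
  using () renaming (interchange to ℤ+-interchange)
open import Algebra.Properties.Group (AbelianGroup.group ℤP.+-0-abelianGroup) using (∙-cancelˡ)

≡ᵇ-sound : ∀ m n → (m ≡ᵇ n) ≡ true → m ≡ n
≡ᵇ-sound m n e = ≡ᵇ⇒≡ m n (subst T (sym e) _)

≡ᵇ-refl : ∀ m → (m ≡ᵇ m) ≡ true
≡ᵇ-refl zero = refl
≡ᵇ-refl (suc m) = ≡ᵇ-refl m

≡ᵇ-false⇒≢ : ∀ m n → (m ≡ᵇ n) ≡ false → m ≢ n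
≡ᵇ-false⇒≢ m .m e refl with () ← trans (sym e) (≡ᵇ-refl m)

<ᵇ-sound : ∀ m n → (m <ᵇ n) ≡ true → m < n
<ᵇ-sound m n e = <ᵇ⇒< m n (subst T (sym e) _)

<⇒<ᵇ≡true : ∀ m n → m < n → (m <ᵇ n) ≡ true
<⇒<ᵇ≡true m n m<n with m <ᵇ n | <⇒<ᵇ m<n
... | true | _ = refl

∧-trueˡ : ∀ {a b} → (a ∧ b) ≡ true → a ≡ true
∧-trueˡ {true} _ = refl

∧-trueʳ : ∀ {a b} → (a ∧ b) ≡ true → b ≡ true
∧-trueʳ {true} e = e

∧-true : ∀ {a b} → a ≡ true → b ≡ true → (a ∧ b) ≡ true
∧-true refl refl = refl

not-false : ∀ {a} → not a ≡ false → a ≡ true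
not-false {true} _ = refl

false≢true : false ≢ true
false≢true ()

_≡ᶠ_ : ∀ {n} → Fin n → Fin n → Bool
i ≡ᶠ j = toℕ i ≡ᵇ toℕ j

≡ᶠ-sound : ∀ {n} {i j : Fin n} → (i ≡ᶠ j) ≡ true → i ≡ j
≡ᶠ-sound {i = i} {j} e = toℕ-injective (≡ᵇ-sound (toℕ i) (toℕ j) e)

≡ᶠ-refl : ∀ {n} (i : Fin n) → (i ≡ᶠ i) ≡ true
≡ᶠ-refl i = ≡ᵇ-refl (toℕ i)

_<ᶠ_ : ∀ {n} → Fin n → Fin n → Bool
i <ᶠ j = toℕ i <ᵇ toℕ j

indicator : Bool → ℕ
indicator true = 1
indicator false = 0

∑ : ∀ {n} → (Fin n → ℕ) → ℕ
∑ {zero} f = 0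
∑ {suc n} f = f zero + ∑ (f ∘ suc)

count : ∀ {n} → (Fin n → Bool) → ℕ
count p = ∑ (indicator ∘ p)

∑-cong : ∀ {n} {f g : Fin n → ℕ} → (∀ i → f i ≡ g i) → ∑ f ≡ ∑ g
∑-cong {zero} e = refl
∑-cong {suc n} e = cong₂ _+_ (e zero) (∑-cong (e ∘ suc))

count-cong : ∀ {n} {p q : Fin n → Bool} → (∀ i → p i ≡ q i) → count p ≡ count q
count-cong e = ∑-cong (cong indicator ∘ e)

∑-+ : ∀ {n} (f g : Fin n → ℕ) → ∑ (λ i → f i + g i) ≡ ∑ f + ∑ g
∑-+ {zero} f g = refl
∑-+ {suc n} f g rewrite ∑-+ (f ∘ suc) (g ∘ suc) =
  +-interchange (f zero) (g zero) (∑ (f ∘ suc)) (∑ (g ∘ suc))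

∑-zero : ∀ {n} (f : Fin n → ℕ) → (∀ i → f i ≡ 0) → ∑ f ≡ 0
∑-zero {zero} f e = refl
∑-zero {suc n} f e rewrite e zero = ∑-zero (f ∘ suc) (e ∘ suc)

∑-swap : ∀ {n m} (f : Fin n → Fin m → ℕ) → ∑ (λ i → ∑ (f i)) ≡ ∑ (λ j → ∑ (λ i → f i j))
∑-swap {zero} {m} f = sym (∑-zero {m} _ (λ _ → refl))
∑-swap {suc n} f =
  trans (cong (_+_ (∑ (f zero))) (∑-swap (f ∘ suc))) (sym (∑-+ (f zero) (λ j → ∑ (λ i → f (suc i) j))))

∑-mono-≤ : ∀ {n} {f g : Fin n → ℕ} → (∀ i → f i ≤ g i) → ∑ f ≤ ∑ g
∑-mono-≤ {zero} e = z≤n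
∑-mono-≤ {suc n} e = +-mono-≤ (e zero) (∑-mono-≤ (e ∘ suc))

∑-↑ : ∀ a b (f : Fin (a + b) → ℕ) → ∑ f ≡ ∑ (λ i → f (i ↑ˡ b)) + ∑ (λ i → f (a ↑ʳ i))
∑-↑ zero b f = refl
∑-↑ (suc a) b f rewrite ∑-↑ a b (f ∘ suc) = sym (+-assoc (f zero) _ _)

count-none : ∀ {n} (p : Fin n → Bool) → (∀ i → p i ≡ false) → count p ≡ 0
count-none p e = ∑-zero _ (cong indicator ∘ e)

count-unique : ∀ {n} (p : Fin n → Bool) (i₀ : Fin n) → p i₀ ≡ true →
  (∀ i → p i ≡ true → i ≡ i₀) → count p ≡ 1
count-unique p zero pi₀ unique rewrite pi₀ = cong suc (count-none (p ∘ suc) outside)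
  where
  outside : ∀ i → p (suc i) ≡ false
  outside i with p (suc i) in e
  ... | true with () ← unique (suc i) e
  ... | false = refl
count-unique p (suc i₀) pi₀ unique with p zero in e
... | true with () ← unique zero e
... | false = count-unique (p ∘ suc) i₀ pi₀ (λ i ei → suc-injective (unique (suc i) ei))

count-mono : ∀ {n} (p q : Fin n → Bool) → (∀ i → p i ≡ true → q i ≡ true) → count p ≤ count q
count-mono p q p⇒q = ∑-mono-≤ pointwise
  where
  pointwise : ∀ i → indicator (p i) ≤ indicator (q i)
  pointwise i with p i in e
  ... | false = z≤n
  ... | true rewrite p⇒q i e = ≤-refl

count≤n : ∀ {n} (p : Fin n → Bool) → count p ≤ n
count≤n {zero} p = z≤n
count≤n {suc n} p with p zero
... | true = s≤s (count≤n (p ∘ suc))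
... | false = m≤n⇒m≤1+n (count≤n (p ∘ suc))

count-true : ∀ n → count {n} (λ _ → true) ≡ n
count-true zero = refl
count-true (suc n) = cong suc (count-true n)

count-≤1 : ∀ {n} (p : Fin n → Bool) → (∀ i j → p i ≡ true → p j ≡ true → i ≡ j) → count p ≤ 1
count-≤1 {zero} p atMostOne = z≤n
count-≤1 {suc n} p atMostOne with p zero in e
... | true = ≤-reflexive (cong suc (count-none (p ∘ suc) outside))
  where
  outside : ∀ i → p (suc i) ≡ false
  outside i with p (suc i) in e′
  ... | false = refl
  ... | true with () ← atMostOne zero (suc i) e e′
... | false = count-≤1 (p ∘ suc) (λ i j ei ej → suc-injective (atMostOne (suc i) (suc j) ei ej))

count-∨ : ∀ {n} (p q : Fin n → Bool) → count (λ i → p i ∨ q i) ≤ count p + count q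
count-∨ p q = ≤-trans (∑-mono-≤ pointwise) (≤-reflexive (∑-+ (indicator ∘ p) (indicator ∘ q)))
  where
  pointwise : ∀ i → indicator (p i ∨ q i) ≤ indicator (p i) + indicator (q i)
  pointwise i with p i | q i
  ... | true | _ = s≤s z≤n
  ... | false | true = ≤-refl
  ... | false | false = z≤n

count-∨-disjoint : ∀ {n} (p q : Fin n → Bool) → (∀ i → (p i ∧ q i) ≡ false) →
  count (λ i → p i ∨ q i) ≡ count p + count q
count-∨-disjoint p q disjoint = trans (∑-cong pointwise) (∑-+ (indicator ∘ p) (indicator ∘ q))
  where
  pointwise : ∀ i → indicator (p i ∨ q i) ≡ indicator (p i) + indicator (q i)
  pointwise i with p i | q i | disjoint i
  ... | true | false | _ = refl
  ... | false | _ | _ = refl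

count-complement : ∀ {n} (p : Fin n → Bool) → count p + count (not ∘ p) ≡ n
count-complement {zero} p = refl
count-complement {suc n} p with p zero
... | true = cong suc (count-complement (p ∘ suc))
... | false = trans (+-suc _ _) (cong suc (count-complement (p ∘ suc)))

countB-tabulate : ∀ {X : Set} {n} (p : X → Bool) (f : Fin n → X) → countB p (tabulate f) ≡ count (p ∘ f)
countB-tabulate {n = zero} p f = refl
countB-tabulate {n = suc n} p f with p (f zero)
... | true = cong suc (countB-tabulate p (f ∘ suc))
... | false = countB-tabulate p (f ∘ suc)

countB-allFin : ∀ n (p : Fin n → Bool) → countB p (allFin n) ≡ count p
countB-allFin n p = countB-tabulate p id

count-matching : ∀ {n m} (P : Fin n → Bool) (Q : Fin m → Bool) (ρ : Fin n → Fin m → Bool) →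
  (∀ x → P x ≡ true → Σ (Fin m) λ y → (Q y ∧ ρ x y) ≡ true × (∀ y′ → (Q y′ ∧ ρ x y′) ≡ true → y′ ≡ y)) →
  (∀ y → Q y ≡ true → Σ (Fin n) λ x → (P x ∧ ρ x y) ≡ true × (∀ x′ → (P x′ ∧ ρ x′ y) ≡ true → x′ ≡ x)) →
  count P ≡ count Q
count-matching {n} {m} P Q ρ matchP matchQ = begin
  ∑ (λ x → indicator (P x))
    ≡⟨ ∑-cong rowP ⟩
  ∑ (λ x → ∑ (λ y → indicator (P x ∧ (Q y ∧ ρ x y))))
    ≡⟨ ∑-swap (λ x y → indicator (P x ∧ (Q y ∧ ρ x y))) ⟩
  ∑ (λ y → ∑ (λ x → indicator (P x ∧ (Q y ∧ ρ x y))))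
    ≡⟨ ∑-cong (λ y → ∑-cong (λ x → cong indicator (∧-swap (P x) (Q y) (ρ x y)))) ⟩
  ∑ (λ y → ∑ (λ x → indicator (Q y ∧ (P x ∧ ρ x y))))
    ≡⟨ ∑-cong rowQ ⟨
  ∑ (λ y → indicator (Q y)) ∎
  where
  open ≡-Reasoning
  ∧-swap : ∀ a b c → (a ∧ (b ∧ c)) ≡ (b ∧ (a ∧ c))
  ∧-swap a b c = trans (sym (∧-assoc a b c)) (trans (cong (_∧ c) (∧-comm a b)) (∧-assoc b a c))
  rowP : ∀ x → indicator (P x) ≡ ∑ (λ y → indicator (P x ∧ (Q y ∧ ρ x y)))
  rowP x with P x in e
  ... | false = sym (∑-zero {m} _ (λ _ → refl))
  ... | true with y , ρxy , unique ← matchP x e = sym (count-unique _ y ρxy unique)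
  rowQ : ∀ y → indicator (Q y) ≡ ∑ (λ x → indicator (Q y ∧ (P x ∧ ρ x y)))
  rowQ y with Q y in e
  ... | false = sym (∑-zero {n} _ (λ _ → refl))
  ... | true with x , ρxy , unique ← matchQ y e = sym (count-unique _ x ρxy unique)

position : ∀ {n} → (Fin n → Bool) → Fin n → ℕ
position p x = count (λ y → y <ᶠ x ∧ p y)

count-before : ∀ {n} (p : Fin n → Bool) x → p x ≡ true → position p x + 1 ≤ count p
count-before p x px = begin
  position p x + 1
    ≡⟨ cong (_+_ (position p x)) onlyX ⟨
  position p x + count (λ z → z ≡ᶠ x ∧ p z)
    ≡⟨ count-∨-disjoint (λ z → z <ᶠ x ∧ p z) (λ z → z ≡ᶠ x ∧ p z) disjoint ⟨
  count (λ z → (z <ᶠ x ∧ p z) ∨ (z ≡ᶠ x ∧ p z))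
    ≤⟨ count-mono _ p (λ z → ∨-sub (z <ᶠ x) (z ≡ᶠ x) (p z)) ⟩
  count p ∎
  where
  open ≤-Reasoning
  onlyX : count (λ z → z ≡ᶠ x ∧ p z) ≡ 1
  onlyX = count-unique _ x (∧-true (≡ᶠ-refl x) px) (λ i e → ≡ᶠ-sound {i = i} (∧-trueˡ {i ≡ᶠ x} e))
  disjoint : ∀ z → ((z <ᶠ x ∧ p z) ∧ (z ≡ᶠ x ∧ p z)) ≡ false
  disjoint z with z <ᶠ x in lt | z ≡ᶠ x in eq
  ... | true | true = ⊥-elim (<-irrefl (cong toℕ (≡ᶠ-sound {i = z} eq)) (<ᵇ-sound _ _ lt))
  ... | true | false = ∧-zeroʳ (p z)
  ... | false | _ = refl
  ∨-sub : ∀ a b c → ((a ∧ c) ∨ (b ∧ c)) ≡ true → c ≡ true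
  ∨-sub _ _ true _ = refl
  ∨-sub true true false ()
  ∨-sub true false false ()
  ∨-sub false true false ()
  ∨-sub false false false ()

position<count : ∀ {n} (p : Fin n → Bool) x → p x ≡ true → position p x < count p
position<count p x px = subst (_≤ count p) (+-comm (position p x) 1) (count-before p x px)

position-mono : ∀ {n} (p : Fin n → Bool) x y → p x ≡ true → toℕ x < toℕ y → position p x < position p y
position-mono p x y px x<y =
  subst (_≤ position p y) (trans (+-comm _ 1) (cong suc (count-cong beforeBoth)))
    (count-before (λ z → z <ᶠ y ∧ p z) x (∧-true (<⇒<ᵇ≡true _ _ x<y) px))
  where
  beforeBoth : ∀ z → (z <ᶠ x ∧ (z <ᶠ y ∧ p z)) ≡ (z <ᶠ x ∧ p z)
  beforeBoth z with z <ᶠ x in z<x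
  ... | false = refl
  ... | true rewrite <⇒<ᵇ≡true (toℕ z) (toℕ y) (<-trans (<ᵇ-sound _ _ z<x) x<y) = refl

position-injective : ∀ {n} (p : Fin n → Bool) x y → p x ≡ true → p y ≡ true →
  position p x ≡ position p y → x ≡ y
position-injective p x y px py e with <-cmp (toℕ x) (toℕ y)
... | tri< x<y _ _ = ⊥-elim (<-irrefl e (position-mono p x y px x<y))
... | tri≈ _ x≡y _ = toℕ-injective x≡y
... | tri> _ _ y<x = ⊥-elim (<-irrefl (sym e) (position-mono p y x py y<x))

position-mono⁻¹ : ∀ {n} (p : Fin n → Bool) x y → p x ≡ true → p y ≡ true →
  position p x < position p y → toℕ x < toℕ y
position-mono⁻¹ p x y px py lt with <-cmp (toℕ x) (toℕ y)
... | tri< x<y _ _ = x<y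
... | tri≈ _ x≡y _ rewrite toℕ-injective {i = x} {j = y} x≡y = ⊥-elim (<-irrefl refl lt)
... | tri> _ _ y<x = ⊥-elim (<-asym lt (position-mono p y x py y<x))

count-by-position : ∀ {n} (p : Fin n → Bool) (h : ℕ → Bool) →
  count (λ x → p x ∧ h (position p x)) ≡ count {count p} (h ∘ toℕ)
count-by-position {zero} p h = refl
count-by-position {suc n} p h with p zero
... | true = cong₂ _+_ (cong (indicator ∘ h) (∑-zero {n} _ (λ _ → refl))) (count-by-position (p ∘ suc) (h ∘ suc))
... | false = count-by-position (p ∘ suc) h

find : ∀ {n} → (Fin n → Bool) → Maybe (Fin n)
find {zero} p = nothing
find {suc n} p = if p zero then just zero else Maybe.map suc (find (p ∘ suc))

find-just : ∀ {n} (p : Fin n → Bool) {x} → find p ≡ just x →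
  p x ≡ true × (∀ y → toℕ y < toℕ x → p y ≡ false)
find-just {suc n} p {x} e with p zero in p0
find-just {suc n} p {.zero} refl | true = p0 , λ y ()
... | false with find (p ∘ suc) in e₁
find-just {suc n} p {.(suc x′)} refl | false | just x′ with px′ , before ← find-just (p ∘ suc) e₁ =
  px′ , λ { zero _ → p0 ; (suc y) (s≤s lt) → before y lt }

find-nothing : ∀ {n} (p : Fin n → Bool) → find p ≡ nothing → ∀ y → p y ≡ false
find-nothing {suc n} p e y with p zero in p0
find-nothing {suc n} p () y | true
... | false with find (p ∘ suc) in e₁
find-nothing {suc n} p () y | false | just _
find-nothing {suc n} p e zero | false | nothing = p0
find-nothing {suc n} p e (suc y) | false | nothing = find-nothing (p ∘ suc) e₁ y

find-cong : ∀ {n} {p q : Fin n → Bool} → (∀ i → p i ≡ q i) → find p ≡ find q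
find-cong {zero} e = refl
find-cong {suc n} {p} {q} e rewrite e zero | find-cong {p = p ∘ suc} {q = q ∘ suc} (e ∘ suc) = refl

find-least : ∀ {n} (p : Fin n → Bool) {x y} → find p ≡ just x → p y ≡ true → toℕ x ≤ toℕ y
find-least p {x} {y} e py with toℕ x ℕ.≤? toℕ y
... | yes x≤y = x≤y
... | no x≰y with () ← trans (sym (proj₂ (find-just p e) y (≰⇒> x≰y))) py

find-complete : ∀ {n} (p : Fin n → Bool) {y} → p y ≡ true → Σ (Fin n) λ x → find p ≡ just x
find-complete p {y} py with find p in e
... | just x = x , refl
... | nothing with () ← trans (sym (find-nothing p e y)) py

Σℤ : {A : Set} → List A → (A → ℤ) → ℤ
Σℤ xs f = sumℤ (map f xs)

Σℤ-++ : {A : Set} (xs ys : List A) (f : A → ℤ) → Σℤ (xs ++ ys) f ≡ Σℤ xs f ℤ.+ Σℤ ys f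
Σℤ-++ [] ys f = sym (ℤP.+-identityˡ _)
Σℤ-++ (x ∷ xs) ys f rewrite Σℤ-++ xs ys f = sym (ℤP.+-assoc (f x) _ _)

Σℤ-map : {A B : Set} (xs : List A) (g : A → B) (f : B → ℤ) → Σℤ (map g xs) f ≡ Σℤ xs (f ∘ g)
Σℤ-map [] g f = refl
Σℤ-map (x ∷ xs) g f = cong (ℤ._+_ (f (g x))) (Σℤ-map xs g f)

Σℤ-cong : {A : Set} (xs : List A) {f g : A → ℤ} → (∀ x → x ∈ xs → f x ≡ g x) → Σℤ xs f ≡ Σℤ xs g
Σℤ-cong [] e = refl
Σℤ-cong (x ∷ xs) e = cong₂ ℤ._+_ (e x (here refl)) (Σℤ-cong xs (λ y y∈xs → e y (there y∈xs)))

Σℤ-cong-≗ : {A : Set} (xs : List A) {f g : A → ℤ} → (∀ x → f x ≡ g x) → Σℤ xs f ≡ Σℤ xs g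
Σℤ-cong-≗ xs e = Σℤ-cong xs (λ x _ → e x)

Σℤ-zero : {A : Set} (xs : List A) → Σℤ xs (λ _ → ℤ.0ℤ) ≡ ℤ.0ℤ
Σℤ-zero [] = refl
Σℤ-zero (x ∷ xs) = trans (ℤP.+-identityˡ _) (Σℤ-zero xs)

Σℤ-+ : {A : Set} (xs : List A) (f g : A → ℤ) → Σℤ xs (λ x → f x ℤ.+ g x) ≡ Σℤ xs f ℤ.+ Σℤ xs g
Σℤ-+ [] f g = refl
Σℤ-+ (x ∷ xs) f g rewrite Σℤ-+ xs f g = ℤ+-interchange (f x) (g x) (Σℤ xs f) (Σℤ xs g)

Σℤ-swap : {A B : Set} (xs : List A) (ys : List B) (f : A → B → ℤ) →
  Σℤ xs (λ x → Σℤ ys (f x)) ≡ Σℤ ys (λ y → Σℤ xs (λ x → f x y))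
Σℤ-swap [] ys f = sym (Σℤ-zero ys)
Σℤ-swap (x ∷ xs) ys f rewrite Σℤ-swap xs ys f = sym (Σℤ-+ ys (f x) _)

Σℤ-*ˡ : {A : Set} (c : ℤ) (xs : List A) (f : A → ℤ) → c ℤ.* Σℤ xs f ≡ Σℤ xs (λ x → c ℤ.* f x)
Σℤ-*ˡ c [] f = ℤP.*-zeroʳ c
Σℤ-*ˡ c (x ∷ xs) f rewrite ℤP.*-distribˡ-+ c (f x) (Σℤ xs f) | Σℤ-*ˡ c xs f = refl

subsets-map : {A B : Set} (g : A → B) (xs : List A) → subsets (map g xs) ≡ map (map g) (subsets xs)
subsets-map g [] = refl
subsets-map g (x ∷ xs) rewrite subsets-map g xs =
  trans (cong (map (map g) (subsets xs) ++_) (trans (sym (map-∘ (subsets xs))) (map-∘ (subsets xs))))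
        (sym (map-++ (map g) (subsets xs) _))

Σℤ-subsets-++ : {A : Set} (xs ys : List A) (f : List A → ℤ) →
  Σℤ (subsets (xs ++ ys)) f ≡ Σℤ (subsets xs) (λ a → Σℤ (subsets ys) (λ b → f (a ++ b)))
Σℤ-subsets-++ [] ys f = sym (ℤP.+-identityʳ _)
Σℤ-subsets-++ (x ∷ xs) ys f = begin
  Σℤ (subsets (xs ++ ys) ++ map (x ∷_) (subsets (xs ++ ys))) f
    ≡⟨ Σℤ-++ (subsets (xs ++ ys)) _ f ⟩
  Σℤ (subsets (xs ++ ys)) f ℤ.+ Σℤ (map (x ∷_) (subsets (xs ++ ys))) f
    ≡⟨ cong₂ ℤ._+_ (Σℤ-subsets-++ xs ys f)
                   (trans (Σℤ-map (subsets (xs ++ ys)) (x ∷_) f) (Σℤ-subsets-++ xs ys (f ∘ (x ∷_)))) ⟩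
  F xs ℤ.+ Σℤ (subsets xs) (λ a → Σℤ (subsets ys) (λ b → f (x ∷ a ++ b)))
    ≡⟨ cong (ℤ._+_ (F xs)) (Σℤ-map (subsets xs) (x ∷_) _) ⟨
  F xs ℤ.+ Σℤ (map (x ∷_) (subsets xs)) (λ a → Σℤ (subsets ys) (λ b → f (a ++ b)))
    ≡⟨ Σℤ-++ (subsets xs) _ _ ⟨
  F (x ∷ xs) ∎
  where
  open ≡-Reasoning
  F : List _ → ℤ
  F zs = Σℤ (subsets zs) (λ a → Σℤ (subsets ys) (λ b → f (a ++ b)))

∈-subsets⇒⊆ : {A : Set} (xs : List A) {ys : List A} → ys ∈ subsets xs → ∀ {z} → z ∈ ys → z ∈ xs
∈-subsets⇒⊆ [] (here refl) ()
∈-subsets⇒⊆ (x ∷ xs) ys∈ z∈ys with ∈-++⁻ (subsets xs) ys∈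
... | inj₁ ys∈′ = there (∈-subsets⇒⊆ xs ys∈′ z∈ys)
... | inj₂ ys∈′ with zs , zs∈ , refl ← ∈-map⁻ (x ∷_) ys∈′ with z∈ys
...   | here refl = here refl
...   | there z∈zs = there (∈-subsets⇒⊆ xs zs∈ z∈zs)

subsets-last : {A : Set} (xs : List A) → Σ (List (List A)) λ proper →
  subsets xs ≡ proper ++ [ xs ] × (∀ ys → ys ∈ proper → length ys < length xs)
subsets-last [] = [] , refl , λ _ ()
subsets-last (x ∷ xs) with proper , eq , shorter ← subsets-last xs =
  proper ++ xs ∷ map (x ∷_) proper , eq′ , shorter′
  where
  eq′ : subsets (x ∷ xs) ≡ (proper ++ xs ∷ map (x ∷_) proper) ++ [ x ∷ xs ]
  eq′ rewrite eq | map-++ (x ∷_) proper [ xs ] | ++-assoc proper [ xs ] (map (x ∷_) proper ++ [ x ∷ xs ])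
            | ++-assoc proper (xs ∷ map (x ∷_) proper) [ x ∷ xs ] = refl
  shorter′ : ∀ ys → ys ∈ proper ++ xs ∷ map (x ∷_) proper → length ys < suc (length xs)
  shorter′ ys ys∈ with ∈-++⁻ proper ys∈
  ... | inj₁ ys∈proper = m<n⇒m<1+n (shorter ys ys∈proper)
  ... | inj₂ (here refl) = ≤-refl
  ... | inj₂ (there ys∈′) with zs , zs∈ , refl ← ∈-map⁻ (x ∷_) ys∈′ = s≤s (shorter zs zs∈)

-- Components

Edge : ℕ → Set
Edge n = Fin n × Fin n

data Linked {n : ℕ} (L : List (Edge n)) : Fin n → Fin n → Set where
  stay : ∀ {a} → Linked L a a
  edge : ∀ {a b} → (a , b) ∈ L → Linked L a b
  back : ∀ {a b} → Linked L a b → Linked L b a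
  _⨾_  : ∀ {a b c} → Linked L a b → Linked L b c → Linked L a c

Linked-map : ∀ {n m} {L : List (Edge n)} {L′ : List (Edge m)} (f : Fin n → Fin m) →
  (∀ {a b} → (a , b) ∈ L → Linked L′ (f a) (f b)) → ∀ {a b} → Linked L a b → Linked L′ (f a) (f b)
Linked-map f h stay = stay
Linked-map f h (edge ab∈L) = h ab∈L
Linked-map f h (back p) = back (Linked-map f h p)
Linked-map f h (p ⨾ q) = Linked-map f h p ⨾ Linked-map f h q

Linked-mono : ∀ {n} {L L′ : List (Edge n)} → (∀ {e} → e ∈ L → e ∈ L′) → ∀ {a b} → Linked L a b → Linked L′ a b
Linked-mono L⊆L′ = Linked-map id (edge ∘ L⊆L′)

Linked-invariant : ∀ {n} {X : Set} {L : List (Edge n)} (g : Fin n → X) →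
  (∀ {a b} → (a , b) ∈ L → g a ≡ g b) → ∀ {a b} → Linked L a b → g a ≡ g b
Linked-invariant g h stay = refl
Linked-invariant g h (edge ab∈L) = h ab∈L
Linked-invariant g h (back p) = sym (Linked-invariant g h p)
Linked-invariant g h (p ⨾ q) = trans (Linked-invariant g h p) (Linked-invariant g h q)

record IsLabelling {n : ℕ} (L : List (Edge n)) (ℓ : Fin n → ℕ) : Set where
  field
    sound    : ∀ a b → ℓ a ≡ ℓ b → Linked L a b
    complete : ∀ a b → Linked L a b → ℓ a ≡ ℓ b
    named    : ∀ a → Σ (Fin n) λ r → toℕ r ≡ ℓ a × ℓ r ≡ ℓ a

toℕ-isLabelling : ∀ {n} → IsLabelling {n} [] toℕ
toℕ-isLabelling = record
  { sound    = λ a b e → subst (Linked [] a) (toℕ-injective e) stay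
  ; complete = λ a b p → Linked-invariant toℕ (λ ()) p
  ; named    = λ a → a , refl , refl
  }

merge-isLabelling : ∀ {n} (L : List (Edge n)) (ℓ : Fin n → ℕ) (x y : Fin n) →
  IsLabelling L ℓ → IsLabelling (L ++ [ (x , y) ]) (merge ℓ (x , y))
merge-isLabelling {n} L ℓ x y isLab = record { sound = sound′ ; complete = complete′ ; named = named′ }
  where
  open IsLabelling isLab
  L′ = L ++ [ (x , y) ]
  ℓ′ = merge ℓ (x , y)
  old : ∀ {a b} → Linked L a b → Linked L′ a b
  old = Linked-mono ∈-++⁺ˡ
  new : Linked L′ x y
  new = edge (∈-++⁺ʳ L (here refl))
  sound′ : ∀ a b → ℓ′ a ≡ ℓ′ b → Linked L′ a b
  sound′ a b e with ℓ a ≡ᵇ ℓ y in ay | ℓ b ≡ᵇ ℓ y in by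
  ... | true  | true  = old (sound a b (trans (≡ᵇ-sound _ _ ay) (sym (≡ᵇ-sound _ _ by))))
  ... | true  | false = old (sound a y (≡ᵇ-sound _ _ ay)) ⨾ (back new ⨾ old (sound x b e))
  ... | false | true  = old (sound a x e) ⨾ (new ⨾ old (sound y b (sym (≡ᵇ-sound _ _ by))))
  ... | false | false = old (sound a b e)
  complete′ : ∀ a b → Linked L′ a b → ℓ′ a ≡ ℓ′ b
  complete′ a b = Linked-invariant ℓ′ onEdges
    where
    onEdges : ∀ {a b} → (a , b) ∈ L′ → ℓ′ a ≡ ℓ′ b
    onEdges {a} {b} ab∈ with ∈-++⁻ L ab∈
    ... | inj₁ ab∈L rewrite complete a b (edge ab∈L) = refl
    ... | inj₂ (here refl) rewrite ≡ᵇ-refl (ℓ y) with ℓ x ≡ᵇ ℓ y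
    ...   | true = refl
    ...   | false = refl
  named′ : ∀ a → Σ (Fin n) λ r → toℕ r ≡ ℓ′ a × ℓ′ r ≡ ℓ′ a
  named′ a with ℓ a ≡ᵇ ℓ y in ay
  ... | true with r , r≡ , ℓr ← named x = r , r≡ , ℓ′r
    where
    ℓ′r : ℓ′ r ≡ ℓ x
    ℓ′r with ℓ r ≡ᵇ ℓ y
    ... | true = refl
    ... | false = ℓr
  named′ a | false with r , r≡ , ℓr ← named a = r , r≡ , ℓ′r
    where
    ℓ′r : ℓ′ r ≡ ℓ a
    ℓ′r rewrite ℓr | ay = refl

labels-isLabelling : ∀ {n} (L : List (Edge n)) → IsLabelling L (labels L)
labels-isLabelling L = extend L [] toℕ-isLabelling
  where
  extend : ∀ {n} (rest done : List (Edge n)) → IsLabelling done (labels done) →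
    IsLabelling (done ++ rest) (labels (done ++ rest))
  extend [] done isLab rewrite ++-identityʳ done = isLab
  extend ((x , y) ∷ rest) done isLab =
    subst (λ L′ → IsLabelling L′ (labels L′)) (++-assoc done [ (x , y) ] rest)
      (extend rest (done ++ [ (x , y) ]) step)
    where
    step : IsLabelling (done ++ [ (x , y) ]) (labels (done ++ [ (x , y) ]))
    step rewrite foldl-++ merge toℕ done [ (x , y) ] = merge-isLabelling done (labels done) x y isLab

labels-sound : ∀ {n} (L : List (Edge n)) a b → labels L a ≡ labels L b → Linked L a b
labels-sound L = IsLabelling.sound (labels-isLabelling L)

labels-complete : ∀ {n} (L : List (Edge n)) a b → Linked L a b → labels L a ≡ labels L b
labels-complete L = IsLabelling.complete (labels-isLabelling L)

labels<n : ∀ {n} (L : List (Edge n)) a → labels L a < n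
labels<n {n} L a with r , r≡ , _ ← IsLabelling.named (labels-isLabelling L) a = subst (_< n) r≡ (toℕ<n r)

firstOfClass : ∀ {n} → (Fin n → ℕ) → Fin n → Bool
firstOfClass κ v = Maybe.maybe (_≡ᶠ v) false (find (λ b → κ b ≡ᵇ κ v))

firstOfClass-sound : ∀ {n} (κ : Fin n → ℕ) v → firstOfClass κ v ≡ true → ∀ b → toℕ b < toℕ v → κ b ≢ κ v
firstOfClass-sound κ v first b b<v κb≡κv with find (λ b → κ b ≡ᵇ κ v) in found
... | just b′ with refl ← ≡ᶠ-sound {i = b′} first =
  <⇒≢ b<v (sym (≤-antisym (find-least _ found b-found) (<⇒≤ b<v)))
  where
  b-found : (κ b ≡ᵇ κ v) ≡ true
  b-found = subst (λ z → (z ≡ᵇ κ v) ≡ true) (sym κb≡κv) (≡ᵇ-refl (κ v))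

firstOfClass-intro : ∀ {n} (κ : Fin n → ℕ) v → (∀ b → toℕ b < toℕ v → κ b ≢ κ v) → firstOfClass κ v ≡ true
firstOfClass-intro κ v noEarlier with b , found ← find-complete (λ b → κ b ≡ᵇ κ v) {v} (≡ᵇ-refl (κ v))
  rewrite found with toℕ b ℕ.<? toℕ v
... | yes b<v = ⊥-elim (noEarlier b b<v (≡ᵇ-sound _ _ (proj₁ (find-just _ found))))
... | no b≮v with refl ← toℕ-injective {i = b} (≤-antisym (find-least _ found (≡ᵇ-refl (κ v))) (≮⇒≥ b≮v)) =
  ≡ᶠ-refl b

firstOfClass-exists : ∀ {n} (κ : Fin n → ℕ) v → Σ (Fin n) λ m → firstOfClass κ m ≡ true × κ m ≡ κ v
firstOfClass-exists κ v with m , found ← find-complete (λ b → κ b ≡ᵇ κ v) {v} (≡ᵇ-refl (κ v))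
  with κm≡ , before ← find-just _ found =
  m , firstOfClass-intro κ m noEarlier , ≡ᵇ-sound _ _ κm≡
  where
  noEarlier : ∀ b → toℕ b < toℕ m → κ b ≢ κ m
  noEarlier b b<m e = ≡ᵇ-false⇒≢ _ _ (before b b<m) (trans e (≡ᵇ-sound _ _ κm≡))

firstOfClass-unique : ∀ {n} (κ : Fin n → ℕ) a b →
  firstOfClass κ a ≡ true → firstOfClass κ b ≡ true → κ a ≡ κ b → a ≡ b
firstOfClass-unique κ a b fa fb e with <-cmp (toℕ a) (toℕ b)
... | tri< a<b _ _ = ⊥-elim (firstOfClass-sound κ b fb a a<b e)
... | tri≈ _ a≡b _ = toℕ-injective a≡b
... | tri> _ _ b<a = ⊥-elim (firstOfClass-sound κ a fa b b<a (sym e))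

firstOfClass-zero : ∀ {n} (κ : Fin (suc n) → ℕ) → firstOfClass κ zero ≡ true
firstOfClass-zero κ = firstOfClass-intro κ zero (λ b ())

isRoot : ∀ {n} → List (Edge n) → Fin n → Bool
isRoot L v = labels L v ≡ᵇ toℕ v

#components : (n : ℕ) → List (Edge n) → ℕ
#components n L = countB (isRoot L) (allFin n)

#classes : ∀ {n} → List (Edge n) → ℕ
#classes L = count (firstOfClass (labels L))

-- Both count the components: each label is carried by exactly one root, and each class has exactly one first vertex.
#components≡#classes : ∀ n (L : List (Edge n)) → #components n L ≡ #classes L
#components≡#classes n L = trans (countB-allFin n _) (count-matching (isRoot L) (firstOfClass κ) sameClass rootMatch firstMatch)
  where
  κ = labels L
  sameClass : Fin n → Fin n → Bool
  sameClass x y = κ x ≡ᵇ κ y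
  rootMatch : ∀ x → isRoot L x ≡ true → Σ (Fin n) λ y → (firstOfClass κ y ∧ sameClass x y) ≡ true ×
    (∀ y′ → (firstOfClass κ y′ ∧ sameClass x y′) ≡ true → y′ ≡ y)
  rootMatch x _ with m , first , κm≡κx ← firstOfClass-exists κ x =
    m , ∧-true first (subst (λ z → (κ x ≡ᵇ z) ≡ true) (sym κm≡κx) (≡ᵇ-refl (κ x))) ,
    λ y′ h → firstOfClass-unique κ y′ m (∧-trueˡ {firstOfClass κ y′} h) first
               (trans (sym (≡ᵇ-sound (κ x) (κ y′) (∧-trueʳ {firstOfClass κ y′} h))) (sym κm≡κx))
  firstMatch : ∀ y → firstOfClass κ y ≡ true → Σ (Fin n) λ x → (isRoot L x ∧ sameClass x y) ≡ true ×
    (∀ x′ → (isRoot L x′ ∧ sameClass x′ y) ≡ true → x′ ≡ x)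
  firstMatch y _ with r , r≡ , κr ← IsLabelling.named (labels-isLabelling L) y =
    r , ∧-true (subst (λ z → (κ r ≡ᵇ z) ≡ true) (trans κr (sym r≡)) (≡ᵇ-refl (κ r)))
               (subst (λ z → (z ≡ᵇ κ y) ≡ true) (sym κr) (≡ᵇ-refl (κ y))) ,
    λ x′ h → toℕ-injective (trans (sym (≡ᵇ-sound (κ x′) (toℕ x′) (∧-trueˡ {isRoot L x′} h)))
                                  (trans (≡ᵇ-sound (κ x′) (κ y) (∧-trueʳ {isRoot L x′} h)) (sym r≡)))

#classes-antitone : ∀ {n} (L L′ : List (Edge n)) → (∀ {e} → e ∈ L → e ∈ L′) → #classes L′ ≤ #classes L
#classes-antitone L L′ L⊆L′ = count-mono _ _ stillFirst
  where
  stillFirst : ∀ v → firstOfClass (labels L′) v ≡ true → firstOfClass (labels L) v ≡ true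
  stillFirst v first = firstOfClass-intro _ v (λ b b<v e → firstOfClass-sound _ v first b b<v
    (labels-complete L′ b v (Linked-mono L⊆L′ (labels-sound L b v e))))

#classes-pos : ∀ {n} (L : List (Edge (suc n))) → 1 ≤ #classes L
#classes-pos L rewrite firstOfClass-zero (labels L) = s≤s z≤n

#classes≤n : ∀ {n} (L : List (Edge n)) → #classes L ≤ n
#classes≤n L = count≤n _

#components≤n : ∀ {n} (L : List (Edge n)) → #components n L ≤ n
#components≤n {n} L = subst (_≤ n) (sym (#components≡#classes n L)) (#classes≤n L)

-- An added edge (x , y) can only demote the root of y's class.
#roots-snoc : ∀ {n} (L : List (Edge n)) (x y : Fin n) →
  count (isRoot L) ≤ count (isRoot (L ++ [ (x , y) ])) + 1
#roots-snoc {n} L x y = begin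
  count (isRoot L)                                       ≤⟨ count-mono (isRoot L) _ stillRoot ⟩
  count (λ v → isRoot (L ++ [ (x , y) ]) v ∨ isRootOfY v) ≤⟨ count-∨ (isRoot (L ++ [ (x , y) ])) isRootOfY ⟩
  count (isRoot (L ++ [ (x , y) ])) + count isRootOfY     ≤⟨ +-monoʳ-≤ _ atMostOne ⟩
  count (isRoot (L ++ [ (x , y) ])) + 1                   ∎
  where
  open ≤-Reasoning
  ℓ = labels L
  isRootOfY : Fin n → Bool
  isRootOfY v = toℕ v ≡ᵇ ℓ y
  stillRoot : ∀ v → isRoot L v ≡ true → (isRoot (L ++ [ (x , y) ]) v ∨ isRootOfY v) ≡ true
  stillRoot v root rewrite foldl-++ merge toℕ L [ (x , y) ] with ℓ v ≡ᵇ ℓ y in vy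
  ... | true = ∨-trueʳ (ℓ x ≡ᵇ toℕ v) (subst (λ z → (z ≡ᵇ ℓ y) ≡ true) (≡ᵇ-sound (ℓ v) (toℕ v) root) vy)
    where
    ∨-trueʳ : ∀ a {b} → b ≡ true → (a ∨ b) ≡ true
    ∨-trueʳ true _ = refl
    ∨-trueʳ false e = e
  ... | false rewrite root = refl
  atMostOne : count isRootOfY ≤ 1
  atMostOne = count-≤1 isRootOfY (λ i j ei ej → toℕ-injective (trans (≡ᵇ-sound _ _ ei) (sym (≡ᵇ-sound _ _ ej))))

n≤#components+length : ∀ {n} (L : List (Edge n)) → n ≤ #components n L + length L
n≤#components+length {n} L = extend L [] base
  where
  roots : List (Edge n) → ℕ
  roots L = count (isRoot L)
  base : n ≤ #components n [] + length {A = Edge n} []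
  base rewrite countB-allFin n (isRoot {n} []) | +-identityʳ (count (isRoot {n} [])) =
    ≤-reflexive (sym (trans (count-cong {n} (λ v → ≡ᵇ-refl (toℕ v))) (count-true n)))
  extend : ∀ (rest done : List (Edge n)) → n ≤ #components n done + length done →
    n ≤ #components n (done ++ rest) + length (done ++ rest)
  extend [] done h rewrite ++-identityʳ done = h
  extend ((x , y) ∷ rest) done h =
    subst (λ L′ → n ≤ #components n L′ + length L′) (++-assoc done [ (x , y) ] rest) (extend rest (done ++ [ (x , y) ]) h′)
    where
    h′ : n ≤ #components n (done ++ [ (x , y) ]) + length (done ++ [ (x , y) ])
    h′ rewrite countB-allFin n (isRoot done) | countB-allFin n (isRoot (done ++ [ (x , y) ])) | length-++ done {[ (x , y) ]} =
      ≤-trans h (≤-trans (+-monoˡ-≤ (length done) (#roots-snoc done x y))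
        (≤-reflexive (trans (+-assoc (roots (done ++ [ (x , y) ])) 1 (length done))
                            (cong (_+_ (roots (done ++ [ (x , y) ]))) (+-comm 1 (length done))))))

-- Added pairs and the inversion of the hypothesis

filterᵇ-cong : {A : Set} {p q : A → Bool} (xs : List A) → (∀ x → x ∈ xs → p x ≡ q x) → filterᵇ p xs ≡ filterᵇ q xs
filterᵇ-cong [] _ = refl
filterᵇ-cong {p = p} {q} (x ∷ xs) p≗q with p x | q x | p≗q x (here refl)
... | true  | true  | _ = cong (x ∷_) (filterᵇ-cong xs (λ y y∈ → p≗q y (there y∈)))
... | false | false | _ = filterᵇ-cong xs (λ y y∈ → p≗q y (there y∈))

module _ {A : Set} (_≟_ : DecidableEquality A) where
  open DecMembership _≟_ using (_∈?_)

  ∈-subsets-filterᵇ⇒∈ : (p : A → Bool) (L : List A) {P : List A} {z : A} →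
    P ∈ subsets (filterᵇ p L) → z ∈ P → z ∈ L
  ∈-subsets-filterᵇ⇒∈ p L P∈ z∈P = proj₁ (∈-filter⁻ (T? ∘ p) (∈-subsets⇒⊆ _ P∈ z∈P))

  subsets-filterᵇ : (p : A → Bool) (L : List A) → Unique L → ∀ {P} →
    P ∈ subsets (filterᵇ p L) → P ≡ filterᵇ (λ z → p z ∧ does (z ∈? P)) L
  subsets-filterᵇ p [] _ (here refl) = refl
  subsets-filterᵇ p (x ∷ L) unique@(_ AllPairs.∷ uniqueL) P∈ with p x
  ... | false = subsets-filterᵇ p L uniqueL P∈
  ... | true with ∈-++⁻ (subsets (filterᵇ p L)) P∈
  ...   | inj₁ P∈′ rewrite dec-false (x ∈? _) (Unique[x∷xs]⇒x∉xs unique ∘ ∈-subsets-filterᵇ⇒∈ p L P∈′) =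
    subsets-filterᵇ p L uniqueL P∈′
  ...   | inj₂ P∈′ with P′ , P′∈ , refl ← ∈-map⁻ (x ∷_) P∈′ rewrite dec-true (x ∈? (x ∷ P′)) (here refl) =
    cong (x ∷_) (trans (subsets-filterᵇ p L uniqueL P′∈) (filterᵇ-cong L (λ z z∈L → cong (p z ∧_) (sameTest z z∈L))))
    where
    sameTest : ∀ z → z ∈ L → does (z ∈? P′) ≡ does (z ∈? (x ∷ P′))
    sameTest z z∈L = does-⇔ (mk⇔ there (λ { (here refl) → ⊥-elim (Unique[x∷xs]⇒x∉xs unique z∈L)
                                           ; (there z∈P′) → z∈P′ }))
                            (z ∈? P′) (z ∈? (x ∷ P′))

Pair : ℕ → Set
Pair k = Fin k × Fin k

allPairs : (k : ℕ) → List (Pair k)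
allPairs k = cartesianProduct (allFin k) (allFin k)

_≟ᵖ_ : ∀ {k} → DecidableEquality (Pair k)
_≟ᵖ_ = ≡-dec F._≟_ F._≟_

length-filterᵇ-tabulate : {A : Set} (p : A → Bool) {n : ℕ} (h : Fin n → A) →
  length (filterᵇ p (tabulate h)) ≡ count (p ∘ h)
length-filterᵇ-tabulate p {zero} h = refl
length-filterᵇ-tabulate p {suc n} h with p (h zero)
... | true = cong suc (length-filterᵇ-tabulate p (h ∘ suc))
... | false = length-filterᵇ-tabulate p (h ∘ suc)

length-filterᵇ-cartesianProduct : ∀ {k} (p : Pair k → Bool) {n} (f : Fin n → Fin k) →
  length (filterᵇ p (cartesianProduct (tabulate f) (allFin k))) ≡ ∑ (λ i → count (λ j → p (f i , j)))
length-filterᵇ-cartesianProduct {k} p {zero} f = refl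
length-filterᵇ-cartesianProduct {k} p {suc n} f = begin
  length (filterᵇ p (map (f zero ,_) (allFin k) ++ cartesianProduct (tabulate (f ∘ suc)) (allFin k)))
    ≡⟨ cong length (filter-++ (T? ∘ p) (map (f zero ,_) (allFin k)) _) ⟩
  length (filterᵇ p (map (f zero ,_) (allFin k)) ++ filterᵇ p (cartesianProduct (tabulate (f ∘ suc)) (allFin k)))
    ≡⟨ length-++ (filterᵇ p (map (f zero ,_) (allFin k))) ⟩
  length (filterᵇ p (map (f zero ,_) (allFin k))) + length (filterᵇ p (cartesianProduct (tabulate (f ∘ suc)) (allFin k)))
    ≡⟨ cong₂ _+_ (trans (cong (length ∘ filterᵇ p) (map-tabulate id (f zero ,_))) (length-filterᵇ-tabulate p (f zero ,_)))
                 (length-filterᵇ-cartesianProduct p (f ∘ suc)) ⟩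
  ∑ (λ i → count (λ j → p (f i , j))) ∎
  where open ≡-Reasoning

isAdded : ∀ {k} → (Fin k → Fin k → Bool) → Pair k → Bool
isAdded S (i , j) = S i j ∧ (i <ᶠ j)

addedPairs : ∀ {k} → (Fin k → Fin k → Bool) → List (Pair k)
addedPairs {k} S = filterᵇ (isAdded S) (allPairs k)

subsets-addedPairs : ∀ {k} (S : Fin k → Fin k → Bool) {P} → P ∈ subsets (addedPairs S) →
  Σ (Fin k → Fin k → Bool) λ S′ → P ≡ addedPairs S′
subsets-addedPairs {k} S {P} P∈ =
  (λ i j → S i j ∧ does ((i , j) ∈? P)) ,
  trans (subsets-filterᵇ _≟ᵖ_ (isAdded S) (allPairs k) (cartesianProduct⁺ (allFin⁺ k) (allFin⁺ k)) P∈)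
        (filterᵇ-cong (allPairs k) (λ { (i , j) _ → ∧-reorder (S i j) (i <ᶠ j) _ }))
  where
  open DecMembership (_≟ᵖ_ {k}) using (_∈?_)
  ∧-reorder : ∀ a b c → ((a ∧ b) ∧ c) ≡ ((a ∧ c) ∧ b)
  ∧-reorder a b c = trans (∧-assoc a b c) (trans (cong (a ∧_) (∧-comm b c)) (sym (∧-assoc a c b)))

withPairs-edges : ∀ {k} (G : Graph) (u : Fin k → Fin (nV G)) (S : Fin k → Fin k → Bool) →
  edges (withPairs G u S) ≡ edges G ++ map (Prod.map u u) (addedPairs S)
withPairs-edges {k} G u S = cong (edges G ++_) (rows (allFin k))
  where
  added : Fin k → Fin k → List (Edge (nV G))
  added i j = if S i j ∧ (toℕ i <ᵇ toℕ j) then [ (u i , u j) ] else []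
  row : ∀ i (js : List (Fin k)) → concatMap (added i) js ≡ map (Prod.map u u) (filterᵇ (isAdded S) (map (i ,_) js))
  row i [] = refl
  row i (j ∷ js) with S i j ∧ (toℕ i <ᵇ toℕ j)
  ... | true = cong ((u i , u j) ∷_) (row i js)
  ... | false = row i js
  rows : ∀ (is : List (Fin k)) → concatMap (λ i → concatMap (added i) (allFin k)) is
    ≡ map (Prod.map u u) (filterᵇ (isAdded S) (cartesianProduct is (allFin k)))
  rows [] = refl
  rows (i ∷ is) = begin
    concatMap (added i) (allFin k) ++ concatMap (λ i → concatMap (added i) (allFin k)) is
      ≡⟨ cong₂ _++_ (row i (allFin k)) (rows is) ⟩
    map (Prod.map u u) (filterᵇ (isAdded S) (map (i ,_) (allFin k)))
      ++ map (Prod.map u u) (filterᵇ (isAdded S) (cartesianProduct is (allFin k)))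
      ≡⟨ map-++ (Prod.map u u) (filterᵇ (isAdded S) (map (i ,_) (allFin k))) _ ⟨
    map (Prod.map u u) (filterᵇ (isAdded S) (map (i ,_) (allFin k))
      ++ filterᵇ (isAdded S) (cartesianProduct is (allFin k)))
      ≡⟨ cong (map (Prod.map u u)) (filter-++ (T? ∘ isAdded S) (map (i ,_) (allFin k)) _) ⟨
    map (Prod.map u u) (filterᵇ (isAdded S) (cartesianProduct (i ∷ is) (allFin k))) ∎
    where open ≡-Reasoning

-- The summand of T at (x , y) for A ⊆ E on n vertices, with the rank r(E) of the whole edge set given as R.
tutteTerm : (n R : ℕ) → List (Edge n) → ℤ → ℤ → ℤ
tutteTerm n R A x y =
  ((x ℤ.- ℤ.+ 1) ℤ.^ (R ∸ (n ∸ #components n A))) ℤ.* ((y ℤ.- ℤ.+ 1) ℤ.^ (length A ∸ (n ∸ #components n A)))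

-- The part of T(G_P) over edge sets containing every added edge.
forcedSum : ∀ {k} (G : Graph) → (Fin k → Fin (nV G)) → List (Pair k) → ℤ → ℤ → ℤ
forcedSum G u P x y = Σℤ (subsets (edges G)) (λ A → tutteTerm (nV G) (nV G ∸ 1) (A ++ map (Prod.map u u) P) x y)

Connected⇒#classes≡1 : ∀ (G : Graph) → Connected G → #classes (edges G) ≡ 1
Connected⇒#classes≡1 G connected = trans (sym (#components≡#classes (nV G) (edges G))) connected

Connected⇒1≤#components : ∀ (G : Graph) → Connected G → ∀ L → 1 ≤ #components (nV G) L
Connected⇒1≤#components (graph zero es) connected L
  with () ← ≤-trans (≤-reflexive (sym (Connected⇒#classes≡1 (graph zero es) connected))) (#classes≤n es)
Connected⇒1≤#components (graph (suc n) es) _ L = subst (1 ≤_) (sym (#components≡#classes (suc n) L)) (#classes-pos L)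

Connected-++ : ∀ (G : Graph) (X : List (Edge (nV G))) → Connected G → #components (nV G) (edges G ++ X) ≡ 1
Connected-++ G X connected = ≤-antisym
  (begin
    #components (nV G) (edges G ++ X) ≡⟨ #components≡#classes (nV G) (edges G ++ X) ⟩
    #classes (edges G ++ X)           ≤⟨ #classes-antitone (edges G) (edges G ++ X) ∈-++⁺ˡ ⟩
    #classes (edges G)                ≡⟨ Connected⇒#classes≡1 G connected ⟩
    1                                 ∎)
  (Connected⇒1≤#components G connected (edges G ++ X))
  where open ≤-Reasoning

tutte-withPairs : ∀ {k} (G : Graph) (u : Fin k → Fin (nV G)) (S : Fin k → Fin k → Bool) x y → Connected G →
  tutte (withPairs G u S) x y ≡ Σℤ (subsets (addedPairs S)) (λ P → forcedSum G u P x y)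
tutte-withPairs {k} G u S x y connected = begin
  tutte (withPairs G u S) x y
    ≡⟨ cong (λ es → Σℤ (subsets es) (λ A → tutteTerm n (n ∸ #components n es) A x y)) (withPairs-edges G u S) ⟩
  Σℤ (subsets (edges G ++ added)) (λ A → tutteTerm n (n ∸ #components n (edges G ++ added)) A x y)
    ≡⟨ cong (λ c → Σℤ (subsets (edges G ++ added)) (λ A → tutteTerm n (n ∸ c) A x y)) (Connected-++ G _ connected) ⟩
  Σℤ (subsets (edges G ++ added)) (λ A → tutteTerm n (n ∸ 1) A x y)
    ≡⟨ Σℤ-subsets-++ (edges G) _ _ ⟩
  Σℤ (subsets (edges G)) (λ A → Σℤ (subsets added) (λ B → tutteTerm n (n ∸ 1) (A ++ B) x y))
    ≡⟨ Σℤ-cong-≗ (subsets (edges G)) (λ A → trans (cong (λ Bs → Σℤ Bs (λ B → tutteTerm n (n ∸ 1) (A ++ B) x y))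
                                                         (subsets-map (Prod.map u u) (addedPairs S)))
                                                   (Σℤ-map (subsets (addedPairs S)) (map (Prod.map u u)) _)) ⟩
  Σℤ (subsets (edges G)) (λ A → Σℤ (subsets (addedPairs S)) (λ P → tutteTerm n (n ∸ 1) (A ++ map (Prod.map u u) P) x y))
    ≡⟨ Σℤ-swap (subsets (edges G)) (subsets (addedPairs S)) _ ⟩
  Σℤ (subsets (addedPairs S)) (λ P → forcedSum G u P x y) ∎
  where
  open ≡-Reasoning
  n = nV G
  added = map (Prod.map u u) (addedPairs S)

-- Möbius inversion over the sublists of addedPairs S, by induction on the number of added pairs.
forcedSum-≡ : ∀ {k} (G H : Graph) (u : Fin k → Fin (nV G)) (v : Fin k → Fin (nV H)) →
  Connected G → Connected H →
  (∀ (S : Fin k → Fin k → Bool) → TEquiv (withPairs G u S) (withPairs H v S)) →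
  ∀ S x y → forcedSum G u (addedPairs S) x y ≡ forcedSum H v (addedPairs S) x y
forcedSum-≡ {k} G H u v connG connH T≡ S x y = go (suc (length (addedPairs S))) S ≤-refl
  where
  go : ∀ m S → length (addedPairs S) < m → forcedSum G u (addedPairs S) x y ≡ forcedSum H v (addedPairs S) x y
  go (suc m) S shorter with proper , eq , properShorter ← subsets-last (addedPairs S) =
    ∙-cancelˡ (rest G u) _ _ (begin
      rest G u ℤ.+ forcedSum G u (addedPairs S) x y     ≡⟨ split G u ⟨
      Σℤ (subsets (addedPairs S)) (λ P → forcedSum G u P x y) ≡⟨ tutte-withPairs G u S x y connG ⟨
      tutte (withPairs G u S) x y                        ≡⟨ T≡ S x y ⟩
      tutte (withPairs H v S) x y                        ≡⟨ tutte-withPairs H v S x y connH ⟩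
      Σℤ (subsets (addedPairs S)) (λ P → forcedSum H v P x y) ≡⟨ split H v ⟩
      rest H v ℤ.+ forcedSum H v (addedPairs S) x y     ≡⟨ cong (λ r → r ℤ.+ forcedSum H v (addedPairs S) x y) restG≡restH ⟨
      rest G u ℤ.+ forcedSum H v (addedPairs S) x y     ∎)
    where
    open ≡-Reasoning
    rest : (K : Graph) → (Fin k → Fin (nV K)) → ℤ
    rest K w = Σℤ proper (λ P → forcedSum K w P x y)
    split : (K : Graph) (w : Fin k → Fin (nV K)) →
      Σℤ (subsets (addedPairs S)) (λ P → forcedSum K w P x y) ≡ rest K w ℤ.+ forcedSum K w (addedPairs S) x y
    split K w rewrite eq | Σℤ-++ proper [ addedPairs S ] (λ P → forcedSum K w P x y) =
      cong (ℤ._+_ (rest K w)) (ℤP.+-identityʳ _)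
    restG≡restH : rest G u ≡ rest H v
    restG≡restH = Σℤ-cong proper onProper
      where
      onProper : ∀ P → P ∈ proper → forcedSum G u P x y ≡ forcedSum H v P x y
      onProper P P∈ with S′ , refl ← subsets-addedPairs S (subst (P ∈_) (sym eq) (∈-++⁺ˡ P∈)) =
        go m S′ (≤-trans (properShorter (addedPairs S′) P∈) (≤-pred shorter))

-- The glued graph

module Terminals {k nW : ℕ} (w : Fin k → Fin nW) (w-injective : Injective _≡_ _≡_ w) where

  preimage-just : ∀ x {i} → preimage w x ≡ just i → w i ≡ x
  preimage-just x = search (allFin k)
    where
    search : ∀ (is : List (Fin k)) {i} →
      foldr (λ i r → if toℕ (w i) ≡ᵇ toℕ x then just i else r) nothing is ≡ just i → w i ≡ x
    search (j ∷ is) e with toℕ (w j) ≡ᵇ toℕ x in wj≡x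
    search (j ∷ is) refl | true = toℕ-injective (≡ᵇ-sound _ _ wj≡x)
    ... | false = search is e

  preimage-nothing : ∀ x → preimage w x ≡ nothing → ∀ i → w i ≢ x
  preimage-nothing x e i = search (allFin k) e i (∈-allFin i)
    where
    search : ∀ (is : List (Fin k)) →
      foldr (λ i r → if toℕ (w i) ≡ᵇ toℕ x then just i else r) nothing is ≡ nothing → ∀ i → i ∈ is → w i ≢ x
    search (j ∷ is) e i i∈ with toℕ (w j) ≡ᵇ toℕ x in wj≡x
    search (j ∷ is) () i i∈ | true
    search (j ∷ is) e i (here refl) | false = ≡ᵇ-false⇒≢ _ _ wj≡x ∘ cong toℕ
    search (j ∷ is) e i (there i∈) | false = search is e i i∈

  preimage-w : ∀ i → preimage w (w i) ≡ just i
  preimage-w i with preimage w (w i) in e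
  ... | just j = cong just (w-injective (preimage-just (w i) e))
  ... | nothing = ⊥-elim (preimage-nothing (w i) e i refl)

  isInner : Fin nW → Bool
  isInner x = not (inImage w x)

  inImage⇒preimage : ∀ x → inImage w x ≡ true → Σ (Fin k) λ i → preimage w x ≡ just i
  inImage⇒preimage x e with preimage w x
  ... | just i = i , refl

  inImage-w : ∀ i → inImage w (w i) ≡ true
  inImage-w i rewrite preimage-w i = refl

  isInner⇒≢w : ∀ x → isInner x ≡ true → ∀ i → w i ≢ x
  isInner⇒≢w x e = preimage-nothing x (nothing-if-inner e)
    where
    nothing-if-inner : isInner x ≡ true → preimage w x ≡ nothing
    nothing-if-inner e with preimage w x
    ... | nothing = refl

  preimage-nothing⇒isInner : ∀ x → preimage w x ≡ nothing → isInner x ≡ true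
  preimage-nothing⇒isInner x e rewrite e = refl

  not-isInner⇒terminal : ∀ x → isInner x ≡ false → Σ (Fin k) λ i → w i ≡ x
  not-isInner⇒terminal x e with i , found ← inImage⇒preimage x (not-false e) = i , preimage-just x found

  #terminals : count (inImage w) ≡ k
  #terminals = trans (count-matching (inImage w) (λ _ → true) (λ x i → w i ≡ᶠ x) matchVertex matchIndex) (count-true k)
    where
    matchVertex : ∀ x → inImage w x ≡ true → Σ (Fin k) λ i → (true ∧ (w i ≡ᶠ x)) ≡ true ×
      (∀ i′ → (true ∧ (w i′ ≡ᶠ x)) ≡ true → i′ ≡ i)
    matchVertex x e with i , found ← inImage⇒preimage x e =
      i , subst (λ z → (w i ≡ᶠ z) ≡ true) (preimage-just x found) (≡ᶠ-refl (w i)) ,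
      λ i′ e′ → w-injective (trans (≡ᶠ-sound {i = w i′} e′) (sym (preimage-just x found)))
    matchIndex : ∀ i → true ≡ true → Σ (Fin nW) λ x → (inImage w x ∧ (w i ≡ᶠ x)) ≡ true ×
      (∀ x′ → (inImage w x′ ∧ (w i ≡ᶠ x′)) ≡ true → x′ ≡ x)
    matchIndex i _ = w i , ∧-true (inImage-w i) (≡ᶠ-refl (w i)) ,
      λ x′ e′ → sym (≡ᶠ-sound {i = w i} (∧-trueʳ {inImage w x′} e′))

  k≤nW : k ≤ nW
  k≤nW = subst (_≤ nW) #terminals (count≤n (inImage w))

  #inner : count isInner ≡ nW ∸ k
  #inner = trans (sym (m+n∸m≡n (count (inImage w)) (count isInner))) (cong₂ _∸_ (count-complement (inImage w)) #terminals)

  -- The B-classes of W: each is free (no terminal) or has a least terminal, its lead.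
  module Classes (B : List (Edge nW)) where

    κ : Fin nW → ℕ
    κ = labels B

    κw : Fin k → ℕ
    κw = κ ∘ w

    firstTerminal : Fin nW → Maybe (Fin k)
    firstTerminal x = find (λ i → κw i ≡ᵇ κ x)

    isLead : Fin k → Bool
    isLead = firstOfClass κw

    S[B] : Fin k → Fin k → Bool
    S[B] i j = isLead i ∧ (κw i ≡ᵇ κw j)

    startsFreeClass : Fin nW → Bool
    startsFreeClass x = firstOfClass κ x ∧ is-nothing (firstTerminal x)

    #free : ℕ
    #free = count startsFreeClass

    firstTerminal-cong : ∀ x y → κ x ≡ κ y → firstTerminal x ≡ firstTerminal y
    firstTerminal-cong x y e = find-cong (λ i → cong (κw i ≡ᵇ_) e)

    firstTerminal-w : ∀ i → Σ (Fin k) λ j → firstTerminal (w i) ≡ just j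
    firstTerminal-w i = find-complete _ (≡ᵇ-refl (κw i))

    firstTerminal-just : ∀ x {i} → firstTerminal x ≡ just i → isLead i ≡ true × κw i ≡ κ x
    firstTerminal-just x {i} e with κi≡κx , before ← find-just _ e =
      firstOfClass-intro κw i (λ b b<i κb≡κi → false≢true (trans (sym (before b b<i))
        (subst (λ z → (z ≡ᵇ κ x) ≡ true) (sym κb≡κi) κi≡κx))) ,
      ≡ᵇ-sound _ _ κi≡κx

    firstTerminal-nothing : ∀ x → firstTerminal x ≡ nothing → ∀ i → κw i ≢ κ x
    firstTerminal-nothing x e i κwi≡κx = false≢true (trans (sym (find-nothing _ e i))
      (subst (λ z → (κw i ≡ᵇ z) ≡ true) κwi≡κx (≡ᵇ-refl (κw i))))

    #classes≡#free+#lead : #classes B ≡ #free + count isLead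
    #classes≡#free+#lead =
      trans (count-cong split)
        (trans (count-∨-disjoint startsFreeClass startsTerminalClass disjoint)
               (cong (_+_ #free) (count-matching _ isLead (λ x i → κ x ≡ᵇ κw i) matchClass matchLead)))
      where
      startsTerminalClass : Fin nW → Bool
      startsTerminalClass x = firstOfClass κ x ∧ not (is-nothing (firstTerminal x))
      split : ∀ x → firstOfClass κ x ≡ (startsFreeClass x ∨ startsTerminalClass x)
      split x with firstOfClass κ x | is-nothing (firstTerminal x)
      ... | true | true = refl
      ... | true | false = refl
      ... | false | _ = refl
      disjoint : ∀ x → (startsFreeClass x ∧ startsTerminalClass x) ≡ false
      disjoint x with firstOfClass κ x | is-nothing (firstTerminal x)
      ... | true | true = refl
      ... | true | false = refl
      ... | false | _ = refl
      matchClass : ∀ x → startsTerminalClass x ≡ true → Σ (Fin k) λ i → (isLead i ∧ (κ x ≡ᵇ κw i)) ≡ true ×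
        (∀ i′ → (isLead i′ ∧ (κ x ≡ᵇ κw i′)) ≡ true → i′ ≡ i)
      matchClass x e with firstTerminal x in found
      ... | nothing with () ← ∧-trueʳ {firstOfClass κ x} e
      ... | just i with lead , κwi≡κx ← firstTerminal-just x found =
        i , ∧-true lead (subst (λ z → (κ x ≡ᵇ z) ≡ true) (sym κwi≡κx) (≡ᵇ-refl (κ x))) ,
        λ i′ e′ → firstOfClass-unique κw i′ i (∧-trueˡ {isLead i′} e′) lead
                    (trans (sym (≡ᵇ-sound (κ x) (κw i′) (∧-trueʳ {isLead i′} e′))) (sym κwi≡κx))
      matchLead : ∀ i → isLead i ≡ true → Σ (Fin nW) λ x → (startsTerminalClass x ∧ (κ x ≡ᵇ κw i)) ≡ true ×
        (∀ x′ → (startsTerminalClass x′ ∧ (κ x′ ≡ᵇ κw i)) ≡ true → x′ ≡ x)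
      matchLead i _ with m , first , κm≡ ← firstOfClass-exists κ (w i) =
        m , ∧-true (∧-true first hasTerminal) (subst (λ z → (z ≡ᵇ κw i) ≡ true) (sym κm≡) (≡ᵇ-refl (κw i))) ,
        λ x′ e′ → firstOfClass-unique κ x′ m (∧-trueˡ {firstOfClass κ x′} (∧-trueˡ {startsTerminalClass x′} e′)) first
                    (trans (≡ᵇ-sound (κ x′) (κw i) (∧-trueʳ {startsTerminalClass x′} e′)) (sym κm≡))
        where
        hasTerminal : not (is-nothing (firstTerminal m)) ≡ true
        hasTerminal with firstTerminal m in found
        ... | just _ = refl
        ... | nothing = ⊥-elim (firstTerminal-nothing m found i (sym κm≡))

    #components≡#free+#lead : #components nW B ≡ #free + count isLead
    #components≡#free+#lead = trans (#components≡#classes nW B) #classes≡#free+#lead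

    -- Each non-lead terminal j is added exactly once, paired with the lead of its class.
    #addedPairs+#lead : length (addedPairs S[B]) + count isLead ≡ k
    #addedPairs+#lead = begin
      length (addedPairs S[B]) + count isLead
        ≡⟨ cong (_+ count isLead) (length-filterᵇ-cartesianProduct (isAdded S[B]) id) ⟩
      ∑ (λ i → count (λ j → isAdded S[B] (i , j))) + count isLead
        ≡⟨ cong (_+ count isLead) (∑-swap (λ i j → indicator (isAdded S[B] (i , j)))) ⟩
      ∑ (λ j → count (λ i → isAdded S[B] (i , j))) + count isLead
        ≡⟨ cong (_+ count isLead) (∑-cong column) ⟩
      count (not ∘ isLead) + count isLead
        ≡⟨ +-comm (count (not ∘ isLead)) (count isLead) ⟩
      count isLead + count (not ∘ isLead)
        ≡⟨ count-complement isLead ⟩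
      k ∎
      where
      open ≡-Reasoning
      column : ∀ j → count (λ i → isAdded S[B] (i , j)) ≡ indicator (not (isLead j))
      column j with isLead j in leadJ
      ... | true = count-none _ noPartner
        where
        noPartner : ∀ i → isAdded S[B] (i , j) ≡ false
        noPartner i with isLead i | κw i ≡ᵇ κw j in same | i <ᶠ j in i<j
        ... | true | true | true = ⊥-elim (firstOfClass-sound κw j leadJ i (<ᵇ-sound _ _ i<j) (≡ᵇ-sound _ _ same))
        ... | true | true | false = refl
        ... | true | false | _ = refl
        ... | false | _ | _ = refl
      ... | false with m , leadM , κm≡κj ← firstOfClass-exists κw j = count-unique _ m added unique
        where
        m<j : toℕ m < toℕ j
        m<j with <-cmp (toℕ m) (toℕ j)
        ... | tri< m<j _ _ = m<j
        ... | tri≈ _ m≡j _ rewrite toℕ-injective {i = m} {j = j} m≡j = ⊥-elim (false≢true (trans (sym leadJ) leadM))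
        ... | tri> _ _ j<m = ⊥-elim (firstOfClass-sound κw m leadM j j<m (sym κm≡κj))
        added : isAdded S[B] (m , j) ≡ true
        added = ∧-true (∧-true leadM (subst (λ z → (z ≡ᵇ κw j) ≡ true) (sym κm≡κj) (≡ᵇ-refl (κw j))))
                       (<⇒<ᵇ≡true _ _ m<j)
        unique : ∀ i → isAdded S[B] (i , j) ≡ true → i ≡ m
        unique i e = firstOfClass-unique κw i m (∧-trueˡ {isLead i} (∧-trueˡ {S[B] i j} e)) leadM
                       (trans (≡ᵇ-sound (κw i) (κw j) (∧-trueʳ {isLead i} (∧-trueˡ {S[B] i j} e))) (sym κm≡κj))

  #free-antitone : ∀ (B B′ : List (Edge nW)) → (∀ {e} → e ∈ B → e ∈ B′) → Classes.#free B′ ≤ Classes.#free B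
  #free-antitone B B′ B⊆B′ = count-mono _ _ stillFree
    where
    module C = Classes B
    module C′ = Classes B′
    coarser : ∀ a b → C.κ a ≡ C.κ b → C′.κ a ≡ C′.κ b
    coarser a b e = labels-complete B′ a b (Linked-mono B⊆B′ (labels-sound B a b e))
    stillFree : ∀ x → C′.startsFreeClass x ≡ true → C.startsFreeClass x ≡ true
    stillFree x e = ∧-true first noTerminal
      where
      first : firstOfClass C.κ x ≡ true
      first = firstOfClass-intro _ x (λ b b<x e′ →
        firstOfClass-sound _ x (∧-trueˡ {firstOfClass C′.κ x} e) b b<x (coarser b x e′))
      noTerminal : is-nothing (C.firstTerminal x) ≡ true
      noTerminal with C.firstTerminal x in found
      ... | nothing = refl
      ... | just i with _ , κwi≡κx ← C.firstTerminal-just x found with C′.firstTerminal x in found′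
      ...   | just _ with () ← ∧-trueʳ {firstOfClass C′.κ x} e
      ...   | nothing = ⊥-elim (C′.firstTerminal-nothing x found′ i (coarser (w i) x κwi≡κx))

mapMaybe-just : {A B : Set} {f : A → Maybe B} (g : A → B) → (∀ x → f x ≡ just (g x)) → ∀ xs → mapMaybe f xs ≡ map g xs
mapMaybe-just g f≡ [] = refl
mapMaybe-just g f≡ (x ∷ xs) rewrite f≡ x = cong (g x ∷_) (mapMaybe-just g f≡ xs)

-- glue's edge maps are local to its definition; this names them (found by unification).
glue-edgeMaps : ∀ {k} (G : Graph) u (W : Graph) w → let N = nV (glue {k} G u W w) in
  Σ (Edge (nV G) → Maybe (Edge N)) λ fG → Σ (Edge (nV W) → Maybe (Edge N)) λ fW →
  edges (glue G u W w) ≡ mapMaybe fG (edges G) ++ mapMaybe fW (edges W)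
glue-edgeMaps G u W w = _ , _ , refl

module Gluing {k : ℕ} (G : Graph) (u : Fin k → Fin (nV G)) (W : Graph) (w : Fin k → Fin (nV W))
              (w-injective : Injective _≡_ _≡_ w) where

  open Terminals w w-injective public

  nG = nV G
  nW = nV W
  N = nG + (nW ∸ k)

  embedG : Fin nG → Fin N
  embedG v = v ↑ˡ (nW ∸ k)

  toℕ-embedG : ∀ v → toℕ (embedG v) ≡ toℕ v
  toℕ-embedG v = toℕ-↑ˡ v (nW ∸ k)

  position<#inner : ∀ x → preimage w x ≡ nothing → position isInner x < nW ∸ k
  position<#inner x e = subst (position isInner x <_) #inner (position<count isInner x (preimage-nothing⇒isInner x e))

  embedW′ : ∀ x (m : Maybe (Fin k)) → preimage w x ≡ m → Fin N
  embedW′ x (just i) _ = embedG (u i)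
  embedW′ x nothing e = nG ↑ʳ fromℕ< (position<#inner x e)

  embedW : Fin nW → Fin N
  embedW x = embedW′ x (preimage w x) refl

  embedW-terminal : ∀ x {i} → preimage w x ≡ just i → embedW x ≡ embedG (u i)
  embedW-terminal x e = go (preimage w x) refl e
    where
    go : ∀ (m : Maybe (Fin k)) (eq : preimage w x ≡ m) {i} → m ≡ just i → embedW′ x m eq ≡ embedG (u i)
    go (just i) eq refl = refl

  embedW-w : ∀ i → embedW (w i) ≡ embedG (u i)
  embedW-w i = embedW-terminal (w i) (preimage-w i)

  embedW-inner : ∀ x → isInner x ≡ true → Σ (Fin (nW ∸ k)) λ r → embedW x ≡ nG ↑ʳ r × toℕ r ≡ position isInner x
  embedW-inner x inner = go (preimage w x) refl
    where
    go : ∀ (m : Maybe (Fin k)) (eq : preimage w x ≡ m) →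
      Σ (Fin (nW ∸ k)) λ r → embedW′ x m eq ≡ nG ↑ʳ r × toℕ r ≡ position isInner x
    go (just i) eq = ⊥-elim (isInner⇒≢w x inner i (preimage-just x eq))
    go nothing eq = fromℕ< (position<#inner x eq) , refl , toℕ-fromℕ< _

  toℕ-embedW-inner : ∀ x → isInner x ≡ true → toℕ (embedW x) ≡ nG + position isInner x
  toℕ-embedW-inner x inner with r , eq , r≡ ← embedW-inner x inner =
    trans (cong toℕ eq) (trans (toℕ-↑ʳ nG r) (cong (_+_ nG) r≡))

  embedEdgeG : Edge nG → Edge N
  embedEdgeG = Prod.map embedG embedG

  embedEdgeW : Edge nW → Edge N
  embedEdgeW = Prod.map embedW embedW

  private
    fG = proj₁ (glue-edgeMaps G u W w)
    fW = proj₁ (proj₂ (glue-edgeMaps G u W w))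

    fG-embed : ∀ e → fG e ≡ just (embedEdgeG e)
    fG-embed (a , b) with toℕ a <? N | toℕ b <? N
    ... | yes p | yes q = cong₂ (λ a′ b′ → just (a′ , b′)) (toℕ-injective (trans (toℕ-fromℕ< p) (sym (toℕ-embedG a))))
                                                          (toℕ-injective (trans (toℕ-fromℕ< q) (sym (toℕ-embedG b))))
    ... | no a≮N | _ = ⊥-elim (a≮N (<-≤-trans (toℕ<n a) (m≤m+n nG _)))
    ... | yes _ | no b≮N = ⊥-elim (b≮N (<-≤-trans (toℕ<n b) (m≤m+n nG _)))

    -- the vertex index glue assigns to a vertex of W
    index : Maybe (Fin k) → Fin nW → ℕ
    index (just i) x = toℕ (u i)
    index nothing x = nG + countB (λ y → (toℕ y <ᵇ toℕ x) ∧ not (inImage w y)) (allFin nW)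

    index-embedW : ∀ x → Σ (index (preimage w x) x < N) λ p → embedW x ≡ fromℕ< p
    index-embedW x = go (preimage w x) refl
      where
      go : ∀ (m : Maybe (Fin k)) (eq : preimage w x ≡ m) → Σ (index m x < N) λ p → embedW′ x m eq ≡ fromℕ< p
      go (just i) eq = p , toℕ-injective (trans (toℕ-embedG (u i)) (sym (toℕ-fromℕ< p)))
        where
        p : toℕ (u i) < N
        p = <-≤-trans (toℕ<n (u i)) (m≤m+n nG _)
      go nothing eq = p , toℕ-injective (trans (toℕ-↑ʳ nG _)
                            (trans (cong (_+_ nG) (trans (toℕ-fromℕ< _) (sym (countB-allFin nW _)))) (sym (toℕ-fromℕ< p))))
        where
        p : index nothing x < N
        p = subst (λ c → nG + c < N) (sym (countB-allFin nW _)) (+-monoʳ-< nG (position<#inner x eq))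

    fW-index : ∀ a b (pa : index (preimage w a) a < N) (pb : index (preimage w b) b < N) →
      fW (a , b) ≡ just (fromℕ< pa , fromℕ< pb)
    fW-index a b pa pb with preimage w a | preimage w b
    ... | just i | just j with index (just i) a <? N | index (just j) b <? N
    ...   | yes _ | yes _ = refl
    ...   | no a≮N | _ = ⊥-elim (a≮N pa)
    ...   | yes _ | no b≮N = ⊥-elim (b≮N pb)
    fW-index a b pa pb | just i | nothing with index (just i) a <? N | index nothing b <? N
    ...   | yes _ | yes _ = refl
    ...   | no a≮N | _ = ⊥-elim (a≮N pa)
    ...   | yes _ | no b≮N = ⊥-elim (b≮N pb)
    fW-index a b pa pb | nothing | just j with index nothing a <? N | index (just j) b <? N
    ...   | yes _ | yes _ = refl
    ...   | no a≮N | _ = ⊥-elim (a≮N pa)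
    ...   | yes _ | no b≮N = ⊥-elim (b≮N pb)
    fW-index a b pa pb | nothing | nothing with index nothing a <? N | index nothing b <? N
    ...   | yes _ | yes _ = refl
    ...   | no a≮N | _ = ⊥-elim (a≮N pa)
    ...   | yes _ | no b≮N = ⊥-elim (b≮N pb)

    fW-embed : ∀ e → fW e ≡ just (embedEdgeW e)
    fW-embed (a , b) with pa , ea ← index-embedW a | pb , eb ← index-embedW b =
      trans (fW-index a b pa pb) (cong₂ (λ a′ b′ → just (a′ , b′)) (sym ea) (sym eb))

  glue-edges : edges (glue G u W w) ≡ map embedEdgeG (edges G) ++ map embedEdgeW (edges W)
  glue-edges = trans (proj₂ (proj₂ (glue-edgeMaps G u W w)))
                     (cong₂ _++_ (mapMaybe-just embedEdgeG fG-embed (edges G)) (mapMaybe-just embedEdgeW fW-embed (edges W)))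

  -- A ∪ B in the glued graph, compared with A ∪ S_B in G.
  module GluedEdgeSet (A : List (Edge nG)) (B : List (Edge nW)) where
    open Classes B public

    glued : List (Edge N)
    glued = map embedEdgeG A ++ map embedEdgeW B

    surrogate : List (Edge nG)
    surrogate = A ++ map (Prod.map u u) (addedPairs S[B])

    ℓG : Fin nG → ℕ
    ℓG = labels surrogate

    ℓ : Fin N → ℕ
    ℓ = labels glued

    linkedW : ∀ {x y} → Linked B x y → Linked glued (embedW x) (embedW y)
    linkedW = Linked-map embedW (λ xy∈B → edge (∈-++⁺ʳ (map embedEdgeG A) (∈-map⁺ embedEdgeW xy∈B)))

    linkedG : ∀ {a b} → Linked surrogate a b → Linked glued (embedG a) (embedG b)
    linkedG = Linked-map embedG onEdge
      where
      onEdge : ∀ {a b} → (a , b) ∈ surrogate → Linked glued (embedG a) (embedG b)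
      onEdge ab∈ with ∈-++⁻ A ab∈
      ... | inj₁ ab∈A = edge (∈-++⁺ˡ (∈-map⁺ embedEdgeG ab∈A))
      ... | inj₂ ab∈S with (i , j) , ij∈ , refl ← ∈-map⁻ (Prod.map u u) ab∈S =
        subst₂ (Linked glued) (embedW-w i) (embedW-w j)
          (linkedW (labels-sound B (w i) (w j) (≡ᵇ-sound _ _ (∧-trueʳ {isLead i} (∧-trueˡ {S[B] i j} added)))))
        where
        added : isAdded S[B] (i , j) ≡ true
        added = Equivalence.to T-≡ (proj₂ (∈-filter⁻ (T? ∘ isAdded S[B]) {xs = allPairs k} ij∈))

    linked-S[B] : ∀ i j → S[B] i j ≡ true → toℕ i < toℕ j → Linked surrogate (u i) (u j)
    linked-S[B] i j e i<j = edge (∈-++⁺ʳ A (∈-map⁺ (Prod.map u u)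
      (∈-filter⁺ (T? ∘ isAdded S[B]) (∈-cartesianProduct⁺ (∈-allFin i) (∈-allFin j))
                 (Equivalence.from T-≡ (∧-true e (<⇒<ᵇ≡true _ _ i<j))))))

    -- A labelling of the glued vertices constant along glued edges: G-vertices keep their ℓG-label, a class of B
    -- with a terminal takes the label of its lead, and a free class is shifted past all ℓG-labels.
    labelW : Fin nW → ℕ
    labelW x with firstTerminal x
    ... | just i = ℓG (u i)
    ... | nothing = nG + κ x

    labelW-cong : ∀ x y → κ x ≡ κ y → labelW x ≡ labelW y
    labelW-cong x y e rewrite firstTerminal-cong x y e with firstTerminal y
    ... | just i = refl
    ... | nothing = cong (_+_ nG) e

    innerAt : Fin (nW ∸ k) → Maybe (Fin nW)
    innerAt r = find (λ x → isInner x ∧ (position isInner x ≡ᵇ toℕ r))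

    -- The junk value for a position with no inner vertex is never met.
    labelInner : Maybe (Fin nW) → ℕ
    labelInner (just x) = labelW x
    labelInner nothing = nG + nW

    label : Fin N → ℕ
    label a with splitAt nG a
    ... | inj₁ v = ℓG v
    ... | inj₂ r = labelInner (innerAt r)

    label-embedG : ∀ v → label (embedG v) ≡ ℓG v
    label-embedG v rewrite splitAt-↑ˡ nG v (nW ∸ k) = refl

    innerAt-position : ∀ x → isInner x ≡ true → (r : Fin (nW ∸ k)) → toℕ r ≡ position isInner x → innerAt r ≡ just x
    innerAt-position x inner r r≡
      with x′ , found ← find-complete (λ x′ → isInner x′ ∧ (position isInner x′ ≡ᵇ toℕ r)) {x}
             (∧-true inner (subst (λ z → (position isInner x ≡ᵇ z) ≡ true) (sym r≡) (≡ᵇ-refl (position isInner x))))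
      with isInner-x′ , _ ← find-just _ found =
      trans found (cong just (position-injective isInner x′ x (∧-trueˡ {isInner x′} isInner-x′) inner
                               (trans (≡ᵇ-sound _ _ (∧-trueʳ {isInner x′} isInner-x′)) r≡)))

    label-embedW-inner : ∀ x → isInner x ≡ true → label (embedW x) ≡ labelW x
    label-embedW-inner x inner with r , eq , r≡ ← embedW-inner x inner
      rewrite eq | splitAt-↑ʳ nG (nW ∸ k) r | innerAt-position x inner r r≡ = refl

    label-embedW-w : ∀ i → label (embedW (w i)) ≡ labelW (w i)
    label-embedW-w i rewrite embedW-w i | label-embedG (u i) with firstTerminal (w i) in found
    ... | nothing = ⊥-elim (firstTerminal-nothing (w i) found i refl)
    ... | just j with lead , κwj≡κwi ← firstTerminal-just (w i) found with <-cmp (toℕ j) (toℕ i)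
    ...   | tri< j<i _ _ = sym (labels-complete surrogate (u j) (u i)
                                  (linked-S[B] j i (∧-true lead (subst (λ z → (κw j ≡ᵇ z) ≡ true) κwj≡κwi (≡ᵇ-refl (κw j)))) j<i))
    ...   | tri≈ _ j≡i _ rewrite toℕ-injective {i = j} {j = i} j≡i = refl
    ...   | tri> _ _ i<j = ⊥-elim (<-irrefl refl (<-≤-trans i<j (find-least _ found (≡ᵇ-refl (κw i)))))

    label-embedW : ∀ x → label (embedW x) ≡ labelW x
    label-embedW x with isInner x in inner
    ... | true = label-embedW-inner x inner
    ... | false with i , refl ← not-isInner⇒terminal x inner = label-embedW-w i

    label-invariant : ∀ {a b} → Linked glued a b → label a ≡ label b
    label-invariant = Linked-invariant label onEdge
      where
      onEdge : ∀ {a b} → (a , b) ∈ glued → label a ≡ label b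
      onEdge ab∈ with ∈-++⁻ (map embedEdgeG A) ab∈
      ... | inj₁ ab∈A with (a , b) , ab∈′ , refl ← ∈-map⁻ embedEdgeG ab∈A =
        trans (label-embedG a) (trans (labels-complete surrogate a b (edge (∈-++⁺ˡ ab∈′))) (sym (label-embedG b)))
      ... | inj₂ ab∈B with (x , y) , xy∈ , refl ← ∈-map⁻ embedEdgeW ab∈B =
        trans (label-embedW x) (trans (labelW-cong x y (labels-complete B x y (edge xy∈))) (sym (label-embedW y)))

    ℓ≡⇒label≡ : ∀ a b → ℓ a ≡ ℓ b → label a ≡ label b
    ℓ≡⇒label≡ a b e = label-invariant (labels-sound glued a b e)

    κ≡⇒ℓ≡ : ∀ x y → κ x ≡ κ y → ℓ (embedW x) ≡ ℓ (embedW y)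
    κ≡⇒ℓ≡ x y e = labels-complete glued _ _ (linkedW (labels-sound B x y e))

    nG≤toℕ-↑ʳ : ∀ (r : Fin (nW ∸ k)) → nG ≤ toℕ (nG ↑ʳ r)
    nG≤toℕ-↑ʳ r = subst (nG ≤_) (sym (toℕ-↑ʳ nG r)) (m≤m+n nG (toℕ r))

    firstOfClass-embedG : ∀ v → firstOfClass ℓ (embedG v) ≡ firstOfClass ℓG v
    firstOfClass-embedG v = ⇔→≡ {z = true} (mk⇔ toG fromG)
      where
      toG : firstOfClass ℓ (embedG v) ≡ true → firstOfClass ℓG v ≡ true
      toG first = firstOfClass-intro ℓG v (λ b b<v e → firstOfClass-sound ℓ (embedG v) first (embedG b)
        (subst₂ _<_ (sym (toℕ-embedG b)) (sym (toℕ-embedG v)) b<v)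
        (labels-complete glued _ _ (linkedG (labels-sound surrogate b v e))))
      fromG : firstOfClass ℓG v ≡ true → firstOfClass ℓ (embedG v) ≡ true
      fromG first = firstOfClass-intro ℓ (embedG v) earlier
        where
        earlier : ∀ a → toℕ a < toℕ (embedG v) → ℓ a ≢ ℓ (embedG v)
        earlier a a<v e with splitAt nG a in split
        ... | inj₁ b with refl ← splitAt⁻¹-↑ˡ split =
          firstOfClass-sound ℓG v first b (subst₂ _<_ (toℕ-embedG b) (toℕ-embedG v) a<v)
            (trans (sym (label-embedG b)) (trans (ℓ≡⇒label≡ _ _ e) (label-embedG v)))
        ... | inj₂ r with refl ← splitAt⁻¹-↑ʳ split =
          <-irrefl refl (<-≤-trans (toℕ<n v) (≤-trans (nG≤toℕ-↑ʳ r) (<⇒≤ (<-≤-trans a<v (≤-reflexive (toℕ-embedG v))))))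

    free-if-firstOfClass-embedW : ∀ x → isInner x ≡ true → firstOfClass ℓ (embedW x) ≡ true → startsFreeClass x ≡ true
    free-if-firstOfClass-embedW x inner first = ∧-true firstInB (free (firstTerminal x) refl)
      where
      terminal<x : ∀ i → toℕ (embedW (w i)) < toℕ (embedW x)
      terminal<x i rewrite embedW-w i | toℕ-embedG (u i) | toℕ-embedW-inner x inner =
        <-≤-trans (toℕ<n (u i)) (m≤m+n nG _)
      free : ∀ t → firstTerminal x ≡ t → is-nothing t ≡ true
      free nothing _ = refl
      free (just i) found with _ , κwi≡κx ← firstTerminal-just x found =
        ⊥-elim (firstOfClass-sound ℓ (embedW x) first (embedW (w i)) (terminal<x i) (κ≡⇒ℓ≡ (w i) x κwi≡κx))
      firstInB : firstOfClass κ x ≡ true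
      firstInB = firstOfClass-intro κ x earlier
        where
        earlier : ∀ b → toℕ b < toℕ x → κ b ≢ κ x
        earlier b b<x e with isInner b in innerB
        ... | true = firstOfClass-sound ℓ (embedW x) first (embedW b)
              (subst₂ _<_ (sym (toℕ-embedW-inner b innerB)) (sym (toℕ-embedW-inner x inner))
                 (+-monoʳ-< nG (position-mono isInner b x innerB b<x)))
              (κ≡⇒ℓ≡ b x e)
        ... | false with i , refl ← not-isInner⇒terminal b innerB =
          ⊥-elim (firstOfClass-sound ℓ (embedW x) first (embedW (w i)) (terminal<x i) (κ≡⇒ℓ≡ (w i) x e))

    firstOfClass-embedW-if-free : ∀ x → isInner x ≡ true → startsFreeClass x ≡ true → firstOfClass ℓ (embedW x) ≡ true
    firstOfClass-embedW-if-free x inner free = firstOfClass-intro ℓ (embedW x) earlier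
      where
      firstInB = ∧-trueˡ {firstOfClass κ x} free
      noTerminal : firstTerminal x ≡ nothing
      noTerminal with firstTerminal x | ∧-trueʳ {firstOfClass κ x} free
      ... | nothing | _ = refl
      label-x : label (embedW x) ≡ nG + κ x
      label-x rewrite label-embedW x | noTerminal = refl
      below : ∀ v → ℓG v ≢ nG + κ x
      below v e = <-irrefl e (<-≤-trans (labels<n surrogate v) (m≤m+n nG (κ x)))
      earlier : ∀ a → toℕ a < toℕ (embedW x) → ℓ a ≢ ℓ (embedW x)
      earlier a a<x e with trans (ℓ≡⇒label≡ _ _ e) label-x
      ... | label-a with splitAt nG a in split
      ...   | inj₁ v with refl ← splitAt⁻¹-↑ˡ split = below v label-a
      ...   | inj₂ r with refl ← splitAt⁻¹-↑ʳ split with innerAt r in found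
      ...     | nothing = <-irrefl (sym label-a) (+-monoʳ-< nG (labels<n B x))
      ...     | just x′ with isInner-x′ , _ ← find-just _ found with firstTerminal x′ in found′
      ...       | just i = below (u i) label-a
      ...       | nothing = firstOfClass-sound κ x firstInB x′ x′<x (+-cancelˡ-≡ nG _ _ label-a)
        where
        x′<x : toℕ x′ < toℕ x
        x′<x = position-mono⁻¹ isInner x′ x (∧-trueˡ {isInner x′} isInner-x′) inner
          (+-cancelˡ-< nG _ _ (subst₂ _<_ (trans (toℕ-↑ʳ nG r) (cong (_+_ nG) (sym (≡ᵇ-sound _ _ (∧-trueʳ {isInner x′} isInner-x′)))))
                                         (toℕ-embedW-inner x inner) a<x))

    firstOfClass-embedW : ∀ x → isInner x ≡ true → firstOfClass ℓ (embedW x) ≡ startsFreeClass x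
    firstOfClass-embedW x inner =
      ⇔→≡ {z = true} (mk⇔ (free-if-firstOfClass-embedW x inner) (firstOfClass-embedW-if-free x inner))

    -- the first-of-class test on glued vertex nG + p (junk false past the end)
    firstAt : ℕ → Bool
    firstAt p with p <? (nW ∸ k)
    ... | yes p< = firstOfClass ℓ (nG ↑ʳ fromℕ< p<)
    ... | no _ = false

    firstAt-toℕ : ∀ (r : Fin (nW ∸ k)) → firstAt (toℕ r) ≡ firstOfClass ℓ (nG ↑ʳ r)
    firstAt-toℕ r with toℕ r <? (nW ∸ k)
    ... | yes r< rewrite fromℕ<-toℕ r r< = refl
    ... | no r≮ = ⊥-elim (r≮ (toℕ<n r))

    firstAt-position : ∀ x → (isInner x ∧ firstAt (position isInner x)) ≡ startsFreeClass x
    firstAt-position x with isInner x in inner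
    ... | true with r , eq , r≡ ← embedW-inner x inner =
      trans (cong firstAt (sym r≡)) (trans (firstAt-toℕ r) (trans (cong (firstOfClass ℓ) (sym eq)) (firstOfClass-embedW x inner)))
    ... | false with i , refl ← not-isInner⇒terminal x inner with j , found ← firstTerminal-w i rewrite found =
      sym (∧-zeroʳ (firstOfClass κ (w i)))

    #classes-glued : #classes glued ≡ #classes surrogate + #free
    #classes-glued = begin
      #classes glued
        ≡⟨ ∑-↑ nG (nW ∸ k) _ ⟩
      count (firstOfClass ℓ ∘ embedG) + count (λ r → firstOfClass ℓ (nG ↑ʳ r))
        ≡⟨ cong₂ _+_ (count-cong firstOfClass-embedG) (count-cong (sym ∘ firstAt-toℕ)) ⟩
      #classes surrogate + count {nW ∸ k} (firstAt ∘ toℕ)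
        ≡⟨ cong (λ n → #classes surrogate + count {n} (firstAt ∘ toℕ)) #inner ⟨
      #classes surrogate + count {count isInner} (firstAt ∘ toℕ)
        ≡⟨ cong (_+_ (#classes surrogate)) (count-by-position isInner firstAt) ⟨
      #classes surrogate + count (λ x → isInner x ∧ firstAt (position isInner x))
        ≡⟨ cong (_+_ (#classes surrogate)) (count-cong firstAt-position) ⟩
      #classes surrogate + #free ∎
      where open ≡-Reasoning

    #components-glued : #components N glued ≡ #components nG surrogate + #free
    #components-glued = begin
      #components N glued              ≡⟨ #components≡#classes N glued ⟩
      #classes glued                   ≡⟨ #classes-glued ⟩
      #classes surrogate + #free       ≡⟨ cong (_+ #free) (#components≡#classes nG surrogate) ⟨
      #components nG surrogate + #free ∎
      where open ≡-Reasoning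

    length-glued : length glued ≡ length A + length B
    length-glued = trans (length-++ (map embedEdgeG A)) (cong₂ _+_ (length-map embedEdgeG A) (length-map embedEdgeW B))

    length-surrogate : length surrogate ≡ length A + length (addedPairs S[B])
    length-surrogate = trans (length-++ A) (cong (_+_ (length A)) (length-map (Prod.map u u) (addedPairs S[B])))

+-∸ : ∀ {a b} → b ≤ a → + (a ∸ b) ≡ + a ℤ.- + b
+-∸ {a} {b} b≤a = trans (sym (ℤP.⊖-≥ b≤a)) (sym (ℤP.m-n≡m⊖n a b))

-- The Tutte polynomial of the glued graph

-- The corank and nullity bookkeeping of a glued edge set, with c components in G and t free classes in W.
corank-glued : ∀ N t₀ c t nG → 1 ≤ c → c ≤ nG → t₀ ≤ t → c + t ≤ N →
  (N ∸ (1 + t₀)) ∸ (N ∸ (c + t)) ≡ ((nG ∸ 1) ∸ (nG ∸ c)) + (t ∸ t₀)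
corank-glued N t₀ c t nG 1≤c c≤nG t₀≤t ct≤N = ℤP.+-injective (begin
  + ((N ∸ (1 + t₀)) ∸ (N ∸ (c + t)))
    ≡⟨ +-∸ (∸-monoʳ-≤ N (+-mono-≤ 1≤c t₀≤t)) ⟩
  + (N ∸ (1 + t₀)) ℤ.- + (N ∸ (c + t))
    ≡⟨ cong₂ ℤ._-_ (trans (+-∸ (≤-trans (+-mono-≤ 1≤c t₀≤t) ct≤N)) (cong (ℤ._-_ (+ N)) (ℤP.pos-+ 1 t₀)))
                   (trans (+-∸ ct≤N) (cong (ℤ._-_ (+ N)) (ℤP.pos-+ c t))) ⟩
  (+ N ℤ.- (+ 1 ℤ.+ + t₀)) ℤ.- (+ N ℤ.- (+ c ℤ.+ + t))
    ≡⟨ rearrange (+ N) (+ t₀) (+ c) (+ t) (+ nG) (+ 1) ⟩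
  ((+ nG ℤ.- + 1) ℤ.- (+ nG ℤ.- + c)) ℤ.+ (+ t ℤ.- + t₀)
    ≡⟨ cong₂ ℤ._+_ (trans (+-∸ (∸-monoʳ-≤ nG 1≤c)) (cong₂ ℤ._-_ (+-∸ (≤-trans 1≤c c≤nG)) (+-∸ c≤nG))) (+-∸ t₀≤t) ⟨
  + ((nG ∸ 1) ∸ (nG ∸ c)) ℤ.+ + (t ∸ t₀)
    ≡⟨ ℤP.pos-+ ((nG ∸ 1) ∸ (nG ∸ c)) (t ∸ t₀) ⟨
  + (((nG ∸ 1) ∸ (nG ∸ c)) + (t ∸ t₀)) ∎)
  where
  open ≡-Reasoning
  rearrange : ∀ (N t₀ c t nG one : ℤ) →
    (N ℤ.- (one ℤ.+ t₀)) ℤ.- (N ℤ.- (c ℤ.+ t)) ≡ ((nG ℤ.- one) ℤ.- (nG ℤ.- c)) ℤ.+ (t ℤ.- t₀)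
  rearrange = solve-∀

-- Here a = |A|, b = |B|, s = |S_B|, ℓ = #leads, with k = s + ℓ and c(B) = t + ℓ.
nullity-glued : ∀ a b s ℓ nG nW k c t N → N ≡ nG + (nW ∸ k) → k ≡ s + ℓ → k ≤ nW → c ≤ nG → c + t ≤ N →
  nG ≤ c + (a + s) → nW ≤ (t + ℓ) + b → t + ℓ ≤ nW →
  (a + b) ∸ (N ∸ (c + t)) ≡ ((a + s) ∸ (nG ∸ c)) + (b ∸ (nW ∸ (t + ℓ)))
nullity-glued a b s ℓ nG nW k c t N N≡ k≡ k≤nW c≤nG ct≤N boundG boundW tℓ≤nW =
  trans (cong (_∸ (N ∸ (c + t))) (sym sum≡)) (m+n∸n≡m (((a + s) ∸ (nG ∸ c)) + (b ∸ (nW ∸ (t + ℓ)))) (N ∸ (c + t)))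
  where
  open ≡-Reasoning
  rearrange : ∀ (a b s ℓ nG nW c t : ℤ) →
    ((a ℤ.+ s) ℤ.- (nG ℤ.- c)) ℤ.+ (b ℤ.- (nW ℤ.- (t ℤ.+ ℓ))) ℤ.+ ((nG ℤ.+ (nW ℤ.- (s ℤ.+ ℓ))) ℤ.- (c ℤ.+ t)) ≡ a ℤ.+ b
  rearrange = solve-∀
  sum≡ : ((a + s) ∸ (nG ∸ c)) + (b ∸ (nW ∸ (t + ℓ))) + (N ∸ (c + t)) ≡ a + b
  sum≡ = ℤP.+-injective (begin
    + (((a + s) ∸ (nG ∸ c)) + (b ∸ (nW ∸ (t + ℓ))) + (N ∸ (c + t)))
      ≡⟨ trans (ℤP.pos-+ (((a + s) ∸ (nG ∸ c)) + (b ∸ (nW ∸ (t + ℓ)))) (N ∸ (c + t)))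
               (cong (λ z → z ℤ.+ + (N ∸ (c + t))) (ℤP.pos-+ ((a + s) ∸ (nG ∸ c)) (b ∸ (nW ∸ (t + ℓ))))) ⟩
    + ((a + s) ∸ (nG ∸ c)) ℤ.+ + (b ∸ (nW ∸ (t + ℓ))) ℤ.+ + (N ∸ (c + t))
      ≡⟨ cong₂ ℤ._+_ (cong₂ ℤ._+_
           (trans (+-∸ (m≤n+o⇒m∸n≤o nG c boundG)) (cong₂ ℤ._-_ (ℤP.pos-+ a s) (+-∸ c≤nG)))
           (trans (+-∸ (m≤n+o⇒m∸n≤o nW (t + ℓ) boundW)) (cong (ℤ._-_ (+ b)) (trans (+-∸ tℓ≤nW) (cong (ℤ._-_ (+ nW)) (ℤP.pos-+ t ℓ))))))
           (trans (+-∸ ct≤N) (cong₂ ℤ._-_ (trans (cong +_ N≡) (trans (ℤP.pos-+ nG (nW ∸ k))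
                    (cong (ℤ._+_ (+ nG)) (trans (+-∸ k≤nW) (cong (ℤ._-_ (+ nW)) (trans (cong +_ k≡) (ℤP.pos-+ s ℓ)))))))
                  (ℤP.pos-+ c t))) ⟩
    ((+ a ℤ.+ + s) ℤ.- (+ nG ℤ.- + c)) ℤ.+ (+ b ℤ.- (+ nW ℤ.- (+ t ℤ.+ + ℓ))) ℤ.+ ((+ nG ℤ.+ (+ nW ℤ.- (+ s ℤ.+ + ℓ))) ℤ.- (+ c ℤ.+ + t))
      ≡⟨ rearrange (+ a) (+ b) (+ s) (+ ℓ) (+ nG) (+ nW) (+ c) (+ t) ⟩
    + a ℤ.+ + b
      ≡⟨ ℤP.pos-+ a b ⟨
    + (a + b) ∎)

-- The W-side factor of the B-terms of T(G ⊔ W): it does not depend on G.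
weight : ∀ {k} (W : Graph) (w : Fin k → Fin (nV W)) → Injective _≡_ _≡_ w → List (Edge (nV W)) → ℤ → ℤ → ℤ
weight W w w-injective B x y =
  ((x ℤ.- + 1) ℤ.^ (#free B ∸ #free (edges W))) ℤ.* ((y ℤ.- + 1) ℤ.^ (length B ∸ (nV W ∸ #components (nV W) B)))
  where open Terminals.Classes w w-injective

module TutteOfGlue {k : ℕ} (G : Graph) (u : Fin k → Fin (nV G)) (W : Graph) (w : Fin k → Fin (nV W))
                   (w-injective : Injective _≡_ _≡_ w) (connected : Connected G) (x y : ℤ) where
  open Gluing G u W w w-injective

  X = x ℤ.- + 1
  Y = y ℤ.- + 1

  monomial : ℕ → ℕ → ℤ
  monomial a b = (X ℤ.^ a) ℤ.* (Y ℤ.^ b)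

  t₀ = Classes.#free (edges W)

  monomial-+ : ∀ a a′ b b′ → monomial (a + a′) (b + b′) ≡ monomial a′ b′ ℤ.* monomial a b
  monomial-+ a a′ b b′ =
    trans (cong₂ ℤ._*_ (ℤP.^-distribˡ-+-* X a a′) (ℤP.^-distribˡ-+-* Y b b′)) (regroup (X ℤ.^ a) (X ℤ.^ a′) (Y ℤ.^ b) (Y ℤ.^ b′))
    where
    regroup : ∀ (p p′ q q′ : ℤ) → (p ℤ.* p′) ℤ.* (q ℤ.* q′) ≡ (p′ ℤ.* q′) ℤ.* (p ℤ.* q)
    regroup = solve-∀

  tutteTerm-glued : ∀ A B → B ∈ subsets (edges W) →
    tutteTerm N (N ∸ (1 + t₀)) (map embedEdgeG A ++ map embedEdgeW B) x y
      ≡ weight W w w-injective B x y ℤ.* tutteTerm nG (nG ∸ 1) (A ++ map (Prod.map u u) (addedPairs (Classes.S[B] B))) x y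
  tutteTerm-glued A B B⊆E = begin
    monomial ((N ∸ (1 + t₀)) ∸ (N ∸ #components N glued)) (length glued ∸ (N ∸ #components N glued))
      ≡⟨ cong₂ monomial (cong (λ z → (N ∸ (1 + t₀)) ∸ (N ∸ z)) #components-glued)
                        (cong₂ (λ a z → a ∸ (N ∸ z)) length-glued #components-glued) ⟩
    monomial ((N ∸ (1 + t₀)) ∸ (N ∸ (c + t))) ((|A| + |B|) ∸ (N ∸ (c + t)))
      ≡⟨ cong₂ monomial (corank-glued N t₀ c t nG 1≤c c≤nG t₀≤t ct≤N)
                        (nullity-glued |A| |B| |S| #lead nG nW k c t N refl (sym #addedPairs+#lead) k≤nW c≤nG ct≤N
                                       boundG boundW cB≤nW) ⟩
    monomial (corankG + (t ∸ t₀)) (nullityG + (|B| ∸ (nW ∸ (t + #lead))))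
      ≡⟨ monomial-+ corankG (t ∸ t₀) nullityG (|B| ∸ (nW ∸ (t + #lead))) ⟩
    monomial (t ∸ t₀) (|B| ∸ (nW ∸ (t + #lead))) ℤ.* monomial corankG nullityG
      ≡⟨ cong₂ ℤ._*_ (cong (λ z → monomial (t ∸ t₀) (|B| ∸ (nW ∸ z))) (sym #components≡#free+#lead))
                     (cong (λ z → monomial corankG (z ∸ (nG ∸ c))) (sym length-surrogate)) ⟩
    monomial (t ∸ t₀) (|B| ∸ (nW ∸ #components nW B)) ℤ.* monomial corankG (length surrogate ∸ (nG ∸ c)) ∎
    where
    open ≡-Reasoning
    open GluedEdgeSet A B
    c = #components nG surrogate
    t = #free
    |A| = length A
    |B| = length B
    |S| = length (addedPairs S[B])
    #lead = count isLead
    corankG = (nG ∸ 1) ∸ (nG ∸ c)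
    nullityG = (|A| + |S|) ∸ (nG ∸ c)
    1≤c : 1 ≤ c
    1≤c = Connected⇒1≤#components G connected surrogate
    c≤nG : c ≤ nG
    c≤nG = #components≤n surrogate
    t₀≤t : t₀ ≤ t
    t₀≤t = #free-antitone B (edges W) (∈-subsets⇒⊆ (edges W) B⊆E)
    ct≤N : c + t ≤ N
    ct≤N = subst (_≤ N) #components-glued (#components≤n glued)
    boundG : nG ≤ c + (|A| + |S|)
    boundG = subst (λ z → nG ≤ c + z) length-surrogate (n≤#components+length surrogate)
    boundW : nW ≤ (t + #lead) + |B|
    boundW = subst (λ z → nW ≤ z + |B|) #components≡#free+#lead (n≤#components+length B)
    cB≤nW : t + #lead ≤ nW
    cB≤nW = subst (_≤ nW) #components≡#free+#lead (#components≤n B)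

  tutte-glue : tutte (glue G u W w) x y
    ≡ Σℤ (subsets (edges W)) (λ B → weight W w w-injective B x y ℤ.* forcedSum G u (addedPairs (Classes.S[B] B)) x y)
  tutte-glue = begin
    tutte (glue G u W w) x y
      ≡⟨ cong (λ es → Σℤ (subsets es) (λ A → tutteTerm N (N ∸ #components N es) A x y)) glue-edges ⟩
    Σℤ (subsets (EG ++ EW)) (λ A → tutteTerm N (N ∸ #components N (EG ++ EW)) A x y)
      ≡⟨ cong (λ c → Σℤ (subsets (EG ++ EW)) (λ A → tutteTerm N (N ∸ c) A x y)) #components-all ⟩
    Σℤ (subsets (EG ++ EW)) (λ A → tutteTerm N R A x y)
      ≡⟨ Σℤ-subsets-++ EG EW _ ⟩
    Σℤ (subsets EG) (λ A′ → Σℤ (subsets EW) (λ B′ → tutteTerm N R (A′ ++ B′) x y))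
      ≡⟨ trans (cong (λ As → Σℤ As (λ A′ → Σℤ (subsets EW) (λ B′ → tutteTerm N R (A′ ++ B′) x y))) (subsets-map embedEdgeG (edges G)))
               (Σℤ-map (subsets (edges G)) (map embedEdgeG) _) ⟩
    Σℤ (subsets (edges G)) (λ A → Σℤ (subsets EW) (λ B′ → tutteTerm N R (map embedEdgeG A ++ B′) x y))
      ≡⟨ Σℤ-cong-≗ (subsets (edges G)) (λ A →
           trans (cong (λ Bs → Σℤ Bs (λ B′ → tutteTerm N R (map embedEdgeG A ++ B′) x y)) (subsets-map embedEdgeW (edges W)))
                 (Σℤ-map (subsets (edges W)) (map embedEdgeW) _)) ⟩
    Σℤ (subsets (edges G)) (λ A → Σℤ (subsets (edges W)) (λ B → tutteTerm N R (map embedEdgeG A ++ map embedEdgeW B) x y))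
      ≡⟨ Σℤ-swap (subsets (edges G)) (subsets (edges W)) _ ⟩
    Σℤ (subsets (edges W)) (λ B → Σℤ (subsets (edges G)) (λ A → tutteTerm N R (map embedEdgeG A ++ map embedEdgeW B) x y))
      ≡⟨ Σℤ-cong (subsets (edges W)) (λ B B⊆E → trans (Σℤ-cong-≗ (subsets (edges G)) (λ A → tutteTerm-glued A B B⊆E))
           (sym (Σℤ-*ˡ (weight W w w-injective B x y) (subsets (edges G)) _))) ⟩
    Σℤ (subsets (edges W)) (λ B → weight W w w-injective B x y ℤ.* forcedSum G u (addedPairs (Classes.S[B] B)) x y) ∎
    where
    open ≡-Reasoning
    EG = map embedEdgeG (edges G)
    EW = map embedEdgeW (edges W)
    R = N ∸ (1 + t₀)
    #components-all : #components N (EG ++ EW) ≡ 1 + t₀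
    #components-all = trans (GluedEdgeSet.#components-glued (edges G) (edges W))
      (cong (_+ t₀) (Connected-++ G _ connected))

theorem3p1 : (k : ℕ) (G H : Graph)
  (u : Fin k → Fin (nV G)) (v : Fin k → Fin (nV H)) →
  Connected G → Connected H →
  Injective _≡_ _≡_ u → Injective _≡_ _≡_ v →
  (∀ (S : Fin k → Fin k → Bool) → TEquiv (withPairs G u S) (withPairs H v S)) →
  (W : Graph) (w : Fin k → Fin (nV W)) → Injective _≡_ _≡_ w →
  TEquiv (glue G u W w) (glue H v W w)
theorem3p1 k G H u v connG connH _ _ T≡ W w w-injective x y = begin
  tutte (glue G u W w) x y
    ≡⟨ TutteOfGlue.tutte-glue G u W w w-injective connG x y ⟩
  Σℤ (subsets (edges W)) (λ B → weight W w w-injective B x y ℤ.* forcedSum G u (S B) x y)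
    ≡⟨ Σℤ-cong-≗ (subsets (edges W)) (λ B →
         cong (weight W w w-injective B x y ℤ.*_) (forcedSum-≡ G H u v connG connH T≡ (S[B] B) x y)) ⟩
  Σℤ (subsets (edges W)) (λ B → weight W w w-injective B x y ℤ.* forcedSum H v (S B) x y)
    ≡⟨ TutteOfGlue.tutte-glue H v W w w-injective connH x y ⟨
  tutte (glue H v W w) x y ∎
  where
  open ≡-Reasoning
  open Terminals.Classes w w-injective using (S[B])
  S : List (Edge (nV W)) → List (Pair k)
  S B = addedPairs (S[B] B)
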